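{- Let $p$ be an odd prime and $l,m,s$ positive integers. Then $$ \sum_{\substack{k=1\\ (k,p)=1}}^{mp^l-1}\frac{1}{k^s}\equiv \begin{cases} 0 \pmod{p^{2l-1}}, & \text{if } s \text{ is odd},\ p-1\mid s+1 \text{ and } p\nmid s,\\ 0 \pmod{p^{2l}}, & \text{if } s \text{ is odd and } (p-1\nmid s+1 \text{ or } p\mid s),\\ 0 \pmod{p^{l-1}}, & \text{if } s \text{ is even and } p-1\mid s,\\ 0 \pmod{p^{l}}, & \text{if } s \text{ is even and } p-1\nmid s. \end{cases} $$
   Context: Congruences between rational numbers with denominators coprime to $p$ are understood in the ring of rationals with denominators coprime to $p$ ($x\equiv 0\pmod{p^r}$ means $x$ has $p$-adic valuation at least $r$). -}

module Defs where

open import Data.Nat using (ℕ; zero; suc; _^_; _∸_; _*_)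
open import Data.Nat.Properties using (m^n≢0)
open import Data.Nat.Coprimality using (Coprime; coprime?)
open import Data.Nat.Divisibility using (_∣_)
open import Data.Integer using (ℤ; +_)
import Data.Integer.Divisibility as ℤD
open import Data.Rational using (ℚ; _/_; _+_; 0ℚ; ↥_; ↧ₙ_)
open import Data.List using (List; map; filter; upTo; foldr)
open import Data.Product using (_×_)
open import Relation.Nullary using (¬_)

invPow : ℕ → ℕ → ℚ
invPow zero s = 0ℚ   -- never used: k ranges over positive integers
invPow (suc j) s = (+ 1) / (suc j ^ s)
  where instance _ = m^n≢0 (suc j) s

-- Σ_{k = 1}^{N - 1}, (k,p) = 1   of  1 / k^s
-- (the indices are k = suc j for j = 0 .. N-2, i.e. k = 1 .. N-1)
coprimeHarmonicSum : (p N s : ℕ) → ℚ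
coprimeHarmonicSum p N s =
  foldr (λ k acc → invPow k s + acc) 0ℚ
    (filter (λ k → coprime? k p) (map suc (upTo (N ∸ 1))))

-- x ≡ 0 (mod p^r) in the ring Z_(p) of rationals with denominator coprime to p:
-- x (in lowest terms) has denominator coprime to p and numerator divisible by p^r.
≡0modPow : (p r : ℕ) → ℚ → Set
≡0modPow p r x = Coprime (↧ₙ x) p × ((+ (p ^ r)) ℤD.∣ (↥ x))

-- Work in ℤ₍ₚ₎; write r ≤ᵥ x for "pʳ divides x there" and H s N for the sum of k⁻ˢ over the
-- units 0 < k < N.  If pᵃ ∣ t then (t + k)⁻ˢ ≡ k⁻ˢ − s t k⁻ˢ⁻¹ (mod p²ᵃ), the first-order
-- expansion of k ↦ k⁻ˢ.  Summing it over the blocks of [0, m pᵃ⁺¹), and using that p divides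
-- 1 + ⋯ + (p − 1) for odd p, lifts v(H s p) ≥ d (d ≤ 1) to v(H s (m pˡ)) ≥ l − 1 + d.  Here d = 0
-- always, and d = 1 when p − 1 ∤ s: by Fermat H s p ≡ Σ_{k<p} k^((p−2)s), and the power sums
-- Σ_{k<p} kʲ vanish mod p for p − 1 ∤ j (binomial recursion for j < p − 1, then Fermat again).
-- This gives the even cases.  For odd s, pairing k with N − k and expanding (N − k)⁻ˢ around
-- (−k)⁻ˢ = −k⁻ˢ gives 2 H s N ≡ −s N H (s + 1) N (mod p^(2l)), and the bounds already proved for
-- the even exponent s + 1 finish the argument.

module Submission where

open import Algebra.Bundles using (CommutativeRing)
open import Data.Empty using (⊥-elim)
import Data.Integer as ℤ
import Data.Integer.Properties as ℤP
open import Data.Integer.Tactic.RingSolver using () renaming (solve-∀ to ℤsolve-∀)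
open import Data.List using ([]; _∷_; map; filter; foldr; applyUpTo)
open import Data.Nat as ℕ using (ℕ; zero; suc; _<_; _≤_; s≤s; z≤n)
open import Data.Nat.Combinatorics using (_C_; nCn≡1; nC1≡n; nCk≡nC[n∸k]; k>n⇒nCk≡0; nCk+nC[k+1]≡[n+1]C[k+1])
open import Data.Nat.Coprimality as Coprime using (Coprime)
open import Data.Nat.Divisibility as ℕD using (_∣_; _∤_; divides)
open import Data.Nat.DivMod using (_%_; _/_; m≡m%n+[m/n]*n; m%n<n)
import Data.Nat.GCD as GCD
open import Data.Nat.Induction using (<-rec)
open import Data.Nat.Primality using (Prime; euclidsLemma; prime⇒irreducible; prime⇒nonZero; prime⇒nonTrivial; prime[2])
import Data.Nat.Properties as ℕP
open import Data.Nat.Tactic.RingSolver using (solve-∀)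
open import Data.Product using (∃; _×_; _,_)
open import Data.Rational as ℚ using (ℚ; 0ℚ; 1ℚ; _+_; _*_; -_; _-_)
import Data.Rational.Properties as ℚP
open import Data.Rational.Solver using (module +-*-Solver)
import Data.Rational.Unnormalised as ℚᵘ
import Data.Rational.Unnormalised.Properties as ℚᵘP
open import Data.Sum using (_⊎_; [_,_]; inj₁; inj₂)
open import Function using (_∘_)
open import Relation.Binary.PropositionalEquality using (_≡_; _≢_; refl; sym; trans; cong; cong₂; subst; module ≡-Reasoning)
open import Relation.Nullary using (¬_; yes; no)
open import Relation.Unary using (Decidable)

open import Defs using (invPow; coprimeHarmonicSum; ≡0modPow)

open CommutativeRing ℚP.+-*-commutativeRing using (semiring; commutativeSemiring)
open import Algebra.Properties.CommutativeSemiring.Exp commutativeSemiring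
  using (_^_; ^-homo-*; ^-assocʳ; ^-distrib-*)
open import Algebra.Properties.Semiring.Mult semiring using (×-homo-+; ×1-homo-*) renaming (_×_ to _·_)
open +-*-Solver
open ≡-Reasoning

ι : ℕ → ℚ
ι n = n · 1ℚ

ι-+ : ∀ m n → ι (m ℕ.+ n) ≡ ι m + ι n
ι-+ = ×-homo-+ 1ℚ

ι-* : ∀ m n → ι (m ℕ.* n) ≡ ι m * ι n
ι-* = ×1-homo-*

ι-*+* : ∀ a b c d → ι (a ℕ.* b ℕ.+ c ℕ.* d) ≡ ι a * ι b + ι c * ι d
ι-*+* a b c d = trans (ι-+ (a ℕ.* b) (c ℕ.* d)) (cong₂ _+_ (ι-* a b) (ι-* c d))

ι-^ : ∀ m n → ι (m ℕ.^ n) ≡ ι m ^ n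
ι-^ m zero    = refl
ι-^ m (suc n) = trans (ι-* m (m ℕ.^ n)) (cong (ι m *_) (ι-^ m n))

0^n≡0 : ∀ n → n ≢ 0 → ι 0 ^ n ≡ 0ℚ
0^n≡0 zero    n≢0 = ⊥-elim (n≢0 refl)
0^n≡0 (suc n) _   = ℚP.*-zeroˡ (ι 0 ^ n)

-‿^-even : ∀ x q → (- x) ^ (2 ℕ.* q) ≡ x ^ (2 ℕ.* q)
-‿^-even x q = begin
  (- x) ^ (2 ℕ.* q)   ≡⟨ sym (^-assocʳ (- x) 2 q) ⟩
  ((- x) ^ 2) ^ q     ≡⟨ cong (_^ q) (solve 1 (λ x → (:- x) :* ((:- x) :* con 1ℚ) := x :* (x :* con 1ℚ)) refl x) ⟩
  (x ^ 2) ^ q         ≡⟨ ^-assocʳ x 2 q ⟩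
  x ^ (2 ℕ.* q)       ∎

odd⇒1+2* : ∀ s → 2 ∤ s → ∃ λ q → s ≡ suc (2 ℕ.* q)
odd⇒1+2* zero          2∤s = ⊥-elim (2∤s (2 ℕD.∣0))
odd⇒1+2* (suc zero)    _   = 0 , refl
odd⇒1+2* (suc (suc s)) 2∤s with odd⇒1+2* s (λ 2∣s → 2∤s (ℕD.∣m∣n⇒∣m+n (ℕD.∣-refl {2}) 2∣s))
... | q , refl = suc q , cong (suc ∘ suc) (sym (ℕP.+-suc q (q ℕ.+ 0)))

-‿^-odd : ∀ x s → 2 ∤ s → (- x) ^ s ≡ - (x ^ s)
-‿^-odd x s 2∤s with odd⇒1+2* s 2∤s
... | q , refl = begin
  (- x) * (- x) ^ (2 ℕ.* q)   ≡⟨ cong ((- x) *_) (-‿^-even x q) ⟩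
  (- x) * x ^ (2 ℕ.* q)       ≡⟨ sym (ℚP.neg-distribˡ-* x (x ^ (2 ℕ.* q))) ⟩
  - (x * x ^ (2 ℕ.* q))       ∎

-- Finite sums

∑ : ℕ → (ℕ → ℚ) → ℚ
∑ zero    f = 0ℚ
∑ (suc n) f = ∑ n f + f n

infix 7 ∑
syntax ∑ n (λ k → e) = ∑[ k < n ] e

∑-cong : ∀ {f g} n → (∀ k → k < n → f k ≡ g k) → ∑ n f ≡ ∑ n g
∑-cong zero    f≡g = refl
∑-cong (suc n) f≡g = cong₂ _+_ (∑-cong n (λ k k<n → f≡g k (ℕP.m<n⇒m<1+n k<n))) (f≡g n ℕP.≤-refl)

∑-+ : ∀ (f g : ℕ → ℚ) n → ∑[ k < n ] (f k + g k) ≡ ∑ n f + ∑ n g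
∑-+ f g zero    = solve 0 (con 0ℚ := con 0ℚ :+ con 0ℚ) refl
∑-+ f g (suc n) = begin
  ∑[ k < n ] (f k + g k) + (f n + g n) ≡⟨ cong (_+ (f n + g n)) (∑-+ f g n) ⟩
  ∑ n f + ∑ n g + (f n + g n)          ≡⟨ solve 4 (λ a b c d → a :+ b :+ (c :+ d) := a :+ c :+ (b :+ d)) refl (∑ n f) (∑ n g) (f n) (g n) ⟩
  ∑ n f + f n + (∑ n g + g n)          ∎

∑-*ˡ : ∀ c (f : ℕ → ℚ) n → ∑[ k < n ] (c * f k) ≡ c * ∑ n f
∑-*ˡ c f zero    = sym (ℚP.*-zeroʳ c)
∑-*ˡ c f (suc n) = trans (cong (_+ c * f n) (∑-*ˡ c f n)) (sym (ℚP.*-distribˡ-+ c (∑ n f) (f n)))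

∑-*ʳ : ∀ (f : ℕ → ℚ) c n → ∑[ k < n ] (f k * c) ≡ ∑ n f * c
∑-*ʳ f c n = begin
  ∑[ k < n ] (f k * c) ≡⟨ ∑-cong n (λ k _ → ℚP.*-comm (f k) c) ⟩
  ∑[ k < n ] (c * f k) ≡⟨ ∑-*ˡ c f n ⟩
  c * ∑ n f            ≡⟨ ℚP.*-comm c (∑ n f) ⟩
  ∑ n f * c            ∎

∑-sub : ∀ (f g : ℕ → ℚ) n → ∑[ k < n ] (f k - g k) ≡ ∑ n f - ∑ n g
∑-sub f g zero    = solve 0 (con 0ℚ := con 0ℚ :- con 0ℚ) refl
∑-sub f g (suc n) = begin
  ∑[ k < n ] (f k - g k) + (f n - g n) ≡⟨ cong (_+ (f n - g n)) (∑-sub f g n) ⟩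
  ∑ n f - ∑ n g + (f n - g n)          ≡⟨ solve 4 (λ a b c d → a :- b :+ (c :- d) := a :+ c :- (b :+ d)) refl (∑ n f) (∑ n g) (f n) (g n) ⟩
  ∑ n f + f n - (∑ n g + g n)          ∎

∑-const : ∀ c n → ∑[ _ < n ] c ≡ ι n * c
∑-const c zero    = sym (ℚP.*-zeroˡ c)
∑-const c (suc n) = begin
  ∑[ _ < n ] c + c ≡⟨ cong (_+ c) (∑-const c n) ⟩
  ι n * c + c      ≡⟨ solve 2 (λ a c → a :* c :+ c := (con 1ℚ :+ a) :* c) refl (ι n) c ⟩
  ι (suc n) * c    ∎

∑-shift : ∀ (f : ℕ → ℚ) n → ∑ (suc n) f ≡ f 0 + ∑[ k < n ] f (suc k)
∑-shift f zero    = solve 1 (λ a → con 0ℚ :+ a := a :+ con 0ℚ) refl (f 0)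
∑-shift f (suc n) = trans (cong (_+ f (suc n)) (∑-shift f n)) (ℚP.+-assoc (f 0) _ _)

∑-split : ∀ (f : ℕ → ℚ) m n → ∑ (m ℕ.+ n) f ≡ ∑ m f + ∑[ k < n ] f (m ℕ.+ k)
∑-split f m zero    = trans (cong (λ i → ∑ i f) (ℕP.+-identityʳ m)) (sym (ℚP.+-identityʳ _))
∑-split f m (suc n) = begin
  ∑ (m ℕ.+ suc n) f                                        ≡⟨ cong (λ i → ∑ i f) (ℕP.+-suc m n) ⟩
  ∑ (m ℕ.+ n) f + f (m ℕ.+ n)                              ≡⟨ cong (_+ f (m ℕ.+ n)) (∑-split f m n) ⟩
  ∑ m f + ∑[ k < n ] f (m ℕ.+ k) + f (m ℕ.+ n)             ≡⟨ ℚP.+-assoc (∑ m f) _ _ ⟩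
  ∑ m f + (∑[ k < n ] f (m ℕ.+ k) + f (m ℕ.+ n))           ∎

∑-blocks : ∀ (f : ℕ → ℚ) M m → ∑ (m ℕ.* M) f ≡ ∑[ i < m ] ∑[ r < M ] f (i ℕ.* M ℕ.+ r)
∑-blocks f M zero    = refl
∑-blocks f M (suc m) = begin
  ∑ (M ℕ.+ m ℕ.* M) f                                      ≡⟨ cong (λ i → ∑ i f) (ℕP.+-comm M (m ℕ.* M)) ⟩
  ∑ (m ℕ.* M ℕ.+ M) f                                      ≡⟨ ∑-split f (m ℕ.* M) M ⟩
  ∑ (m ℕ.* M) f + ∑[ r < M ] f (m ℕ.* M ℕ.+ r)             ≡⟨ cong (_+ ∑[ r < M ] f (m ℕ.* M ℕ.+ r)) (∑-blocks f M m) ⟩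
  ∑[ i < m ] ∑[ r < M ] f (i ℕ.* M ℕ.+ r) + ∑[ r < M ] f (m ℕ.* M ℕ.+ r) ∎

∑-reverse : ∀ (f : ℕ → ℚ) n → ∑ n f ≡ ∑[ k < n ] f (n ℕ.∸ suc k)
∑-reverse f zero    = refl
∑-reverse f (suc n) = begin
  ∑ n f + f n                          ≡⟨ ℚP.+-comm (∑ n f) (f n) ⟩
  f n + ∑ n f                          ≡⟨ cong (f n +_) (∑-reverse f n) ⟩
  f n + ∑[ k < n ] f (n ℕ.∸ suc k)     ≡⟨ sym (∑-shift (λ k → f (suc n ℕ.∸ suc k)) n) ⟩
  ∑[ k < suc n ] f (suc n ℕ.∸ suc k)   ∎

∑-reflect : ∀ (f : ℕ → ℚ) n → f 0 ≡ f n → ∑ n f ≡ ∑[ k < n ] f (n ℕ.∸ k)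
∑-reflect f n f0≡fn = begin
  ∑ n f                                  ≡⟨ solve 2 (λ a b → a := a :+ b :- b) refl (∑ n f) (f n) ⟩
  ∑ n f + f n - f n                      ≡⟨ cong (_- f n) (∑-shift f n) ⟩
  f 0 + ∑[ k < n ] f (suc k) - f n       ≡⟨ cong (λ z → z + ∑[ k < n ] f (suc k) - f n) f0≡fn ⟩
  f n + ∑[ k < n ] f (suc k) - f n       ≡⟨ solve 2 (λ a b → a :+ b :- a := b) refl (f n) (∑[ k < n ] f (suc k)) ⟩
  ∑[ k < n ] f (suc k)                   ≡⟨ ∑-reverse (λ k → f (suc k)) n ⟩
  ∑[ k < n ] f (suc (n ℕ.∸ suc k))       ≡⟨ ∑-cong n (λ k k<n → cong f (sym (ℕP.+-∸-assoc 1 k<n))) ⟩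
  ∑[ k < n ] f (n ℕ.∸ k)                 ∎

∑-zero : ∀ n → ∑[ _ < n ] 0ℚ ≡ 0ℚ
∑-zero zero    = refl
∑-zero (suc n) = cong (_+ 0ℚ) (∑-zero n)

∑-comm : ∀ (g : ℕ → ℕ → ℚ) m n → ∑[ i < m ] ∑[ j < n ] g i j ≡ ∑[ j < n ] ∑[ i < m ] g i j
∑-comm g zero    n = sym (∑-zero n)
∑-comm g (suc m) n = begin
  ∑[ i < m ] ∑[ j < n ] g i j + ∑[ j < n ] g m j   ≡⟨ cong (_+ ∑[ j < n ] g m j) (∑-comm g m n) ⟩
  ∑[ j < n ] ∑[ i < m ] g i j + ∑[ j < n ] g m j   ≡⟨ sym (∑-+ (λ j → ∑[ i < m ] g i j) (λ j → g m j) n) ⟩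
  ∑[ j < n ] ∑[ i < suc m ] g i j                  ∎

∑-telescope : ∀ (f : ℕ → ℚ) n → ∑[ k < n ] (f (suc k) - f k) ≡ f n - f 0
∑-telescope f zero    = sym (ℚP.+-inverseʳ (f 0))
∑-telescope f (suc n) = begin
  ∑[ k < n ] (f (suc k) - f k) + (f (suc n) - f n) ≡⟨ cong (_+ (f (suc n) - f n)) (∑-telescope f n) ⟩
  f n - f 0 + (f (suc n) - f n)                    ≡⟨ solve 3 (λ a b c → a :- b :+ (c :- a) := c :- b) refl (f n) (f 0) (f (suc n)) ⟩
  f (suc n) - f 0                                  ∎

2*∑ι : ∀ n → ι 2 * ∑ (suc n) ι ≡ ι (suc n) * ι n
2*∑ι zero    = solve 0 (con (ι 2) :* (con 0ℚ :+ con 0ℚ) := (con 1ℚ :+ con 0ℚ) :* con 0ℚ) refl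
2*∑ι (suc n) = begin
  ι 2 * (∑ (suc n) ι + ι (suc n))        ≡⟨ ℚP.*-distribˡ-+ (ι 2) (∑ (suc n) ι) (ι (suc n)) ⟩
  ι 2 * ∑ (suc n) ι + ι 2 * ι (suc n)    ≡⟨ cong (_+ ι 2 * ι (suc n)) (2*∑ι n) ⟩
  ι (suc n) * ι n + ι 2 * ι (suc n)      ≡⟨ solve 1 (λ a → (con 1ℚ :+ a) :* a :+ (con 1ℚ :+ (con 1ℚ :+ con 0ℚ)) :* (con 1ℚ :+ a)
                                                          := (con 1ℚ :+ (con 1ℚ :+ a)) :* (con 1ℚ :+ a)) refl (ι n) ⟩
  ι (suc (suc n)) * ι (suc n)            ∎

foldr-filter : ∀ {P : ℕ → Set} (P? : Decidable P) (g f : ℕ → ℚ) → (∀ {k} → P k → f k ≡ g k) → (∀ {k} → ¬ P k → f k ≡ 0ℚ) →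
               ∀ xs → foldr (λ k acc → g k + acc) 0ℚ (filter P? xs) ≡ foldr (λ k acc → f k + acc) 0ℚ xs
foldr-filter P? g f f≡g f≡0 []       = refl
foldr-filter P? g f f≡g f≡0 (k ∷ ks) with P? k
... | yes Pk = cong₂ _+_ (sym (f≡g Pk)) (foldr-filter P? g f f≡g f≡0 ks)
... | no ¬Pk = begin
  foldr (λ k acc → g k + acc) 0ℚ (filter P? ks)  ≡⟨ foldr-filter P? g f f≡g f≡0 ks ⟩
  rest                                           ≡⟨ sym (ℚP.+-identityˡ rest) ⟩
  0ℚ + rest                                      ≡⟨ cong (_+ rest) (sym (f≡0 ¬Pk)) ⟩
  f k + rest                                     ∎
  where rest = foldr (λ k acc → f k + acc) 0ℚ ks

foldr-map-suc-applyUpTo : ∀ (f : ℕ → ℚ) g n →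
  foldr (λ k acc → f k + acc) 0ℚ (map suc (applyUpTo g n)) ≡ ∑[ i < n ] f (suc (g i))
foldr-map-suc-applyUpTo f g zero    = refl
foldr-map-suc-applyUpTo f g (suc n) = trans (cong (f (suc (g 0)) +_) (foldr-map-suc-applyUpTo f (λ i → g (suc i)) n))
                                            (sym (∑-shift (λ i → f (suc (g i))) n))

-- Binomial coefficients

C-absorption : ∀ n k → suc k ℕ.* (suc n C suc k) ≡ suc n ℕ.* (n C k)
C-absorption zero    zero    = refl
C-absorption zero    (suc k) = ℕP.*-zeroʳ (suc (suc k))
C-absorption (suc n) zero    =
  trans (ℕP.*-identityˡ _) (trans (nC1≡n (suc (suc n))) (sym (ℕP.*-identityʳ (suc (suc n)))))
C-absorption (suc n) (suc k) = begin
  suc (suc k) ℕ.* (suc (suc n) C suc (suc k))           ≡⟨ cong (suc (suc k) ℕ.*_) (sym (nCk+nC[k+1]≡[n+1]C[k+1] (suc n) (suc k))) ⟩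
  suc (suc k) ℕ.* (A ℕ.+ B)                             ≡⟨ regroup k A B ⟩
  A ℕ.+ (suc k ℕ.* A ℕ.+ suc (suc k) ℕ.* B)             ≡⟨ cong₂ (λ x y → A ℕ.+ (x ℕ.+ y)) (C-absorption n k) (C-absorption n (suc k)) ⟩
  A ℕ.+ (suc n ℕ.* (n C k) ℕ.+ suc n ℕ.* (n C suc k))   ≡⟨ cong (A ℕ.+_) (sym (ℕP.*-distribˡ-+ (suc n) (n C k) (n C suc k))) ⟩
  A ℕ.+ suc n ℕ.* (n C k ℕ.+ n C suc k)                 ≡⟨ cong (λ x → A ℕ.+ suc n ℕ.* x) (nCk+nC[k+1]≡[n+1]C[k+1] n k) ⟩
  suc (suc n) ℕ.* A                                     ∎
  where
  A = suc n C suc k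
  B = suc n C suc (suc k)
  regroup : ∀ k a b → suc (suc k) ℕ.* (a ℕ.+ b) ≡ a ℕ.+ (suc k ℕ.* a ℕ.+ suc (suc k) ℕ.* b)
  regroup = solve-∀

prime∣pCk : ∀ {p k} → Prime p → 0 < k → k < p → p ∣ p C k
prime∣pCk {suc p-1} {suc k-1} p-prime _ k<p
  with euclidsLemma (suc k-1) _ p-prime (divides (p-1 C k-1) (trans (C-absorption p-1 k-1) (ℕP.*-comm (suc p-1) _)))
... | inj₁ p∣k   = ⊥-elim (ℕP.<⇒≱ k<p (ℕD.∣⇒≤ p∣k))
... | inj₂ p∣pCk = p∣pCk

[1+n]Cn≡1+n : ∀ n → suc n C n ≡ suc n
[1+n]Cn≡1+n n = trans (nCk≡nC[n∸k] (ℕP.n≤1+n n)) (trans (cong (suc n C_) (ℕP.m+n∸n≡m 1 n)) (nC1≡n (suc n)))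

binomial : ∀ x n → (1ℚ + x) ^ n ≡ ∑[ i < suc n ] (ι (n C i) * x ^ i)
binomial x zero    = solve 0 (con 1ℚ := con 0ℚ :+ (con 1ℚ :+ con 0ℚ) :* con 1ℚ) refl
binomial x (suc n) = begin
  (1ℚ + x) * (1ℚ + x) ^ n                                 ≡⟨ cong ((1ℚ + x) *_) (binomial x n) ⟩
  (1ℚ + x) * ∑ (suc n) c                                  ≡⟨ solve 2 (λ x s → (con 1ℚ :+ x) :* s := s :+ x :* s) refl x (∑ (suc n) c) ⟩
  ∑ (suc n) c + x * ∑ (suc n) c                           ≡⟨ cong₂ _+_ (∑-shift c n) (sym (∑-*ˡ x c (suc n))) ⟩
  (c 0 + ∑ n c₊) + ∑[ i < suc n ] (x * c i)               ≡⟨ cong₂ (λ s t → (c 0 + s) + t) c₊-top (∑-cong (suc n) (λ i _ → x*c i)) ⟩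
  (c 0 + ∑ (suc n) c₊) + ∑ (suc n) xc                     ≡⟨ solve 3 (λ u s t → (u :+ s) :+ t := u :+ (t :+ s)) refl (c 0) (∑ (suc n) c₊) (∑ (suc n) xc) ⟩
  c 0 + (∑ (suc n) xc + ∑ (suc n) c₊)                     ≡⟨ cong (c 0 +_) (sym (∑-+ xc c₊ (suc n))) ⟩
  c 0 + ∑[ i < suc n ] (xc i + c₊ i)                      ≡⟨ cong (c 0 +_) (∑-cong (suc n) (λ i _ → pascal i)) ⟩
  c′ 0 + ∑[ i < suc n ] c′ (suc i)                        ≡⟨ sym (∑-shift c′ (suc n)) ⟩
  ∑ (suc (suc n)) c′                                      ∎
  where
  c c′ c₊ xc : ℕ → ℚ
  c  i = ι (n C i) * x ^ i
  c′ i = ι (suc n C i) * x ^ i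
  c₊ i = ι (n C suc i) * x ^ suc i
  xc i = ι (n C i) * x ^ suc i
  c₊-top : ∑ n c₊ ≡ ∑ (suc n) c₊
  c₊-top = begin
    ∑ n c₊                                  ≡⟨ solve 2 (λ s y → s := s :+ con 0ℚ :* y) refl (∑ n c₊) (x ^ suc n) ⟩
    ∑ n c₊ + ι 0 * x ^ suc n                ≡⟨ cong (λ m → ∑ n c₊ + ι m * x ^ suc n) (sym (k>n⇒nCk≡0 (ℕP.n<1+n n))) ⟩
    ∑ (suc n) c₊                            ∎
  x*c : ∀ i → x * c i ≡ xc i
  x*c i = solve 3 (λ x a y → x :* (a :* y) := a :* (x :* y)) refl x (ι (n C i)) (x ^ i)
  pascal : ∀ i → xc i + c₊ i ≡ c′ (suc i)
  pascal i = begin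
    ι (n C i) * x ^ suc i + ι (n C suc i) * x ^ suc i   ≡⟨ sym (ℚP.*-distribʳ-+ (x ^ suc i) (ι (n C i)) (ι (n C suc i))) ⟩
    (ι (n C i) + ι (n C suc i)) * x ^ suc i             ≡⟨ cong (_* x ^ suc i) (sym (ι-+ (n C i) (n C suc i))) ⟩
    ι (n C i ℕ.+ n C suc i) * x ^ suc i                 ≡⟨ cong (λ m → ι m * x ^ suc i) (nCk+nC[k+1]≡[n+1]C[k+1] n i) ⟩
    ι (suc n C suc i) * x ^ suc i                       ∎

binomial-difference : ∀ x j → (1ℚ + x) ^ suc j - x ^ suc j ≡ ∑[ i < suc j ] (ι (suc j C i) * x ^ i)
binomial-difference x j = begin
  (1ℚ + x) ^ suc j - x ^ suc j                              ≡⟨ cong (_- x ^ suc j) (binomial x (suc j)) ⟩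
  ∑ (suc j) c + ι (suc j C suc j) * x ^ suc j - x ^ suc j   ≡⟨ cong (λ m → ∑ (suc j) c + ι m * x ^ suc j - x ^ suc j) (nCn≡1 (suc j)) ⟩
  ∑ (suc j) c + ι 1 * x ^ suc j - x ^ suc j                 ≡⟨ solve 2 (λ s y → s :+ (con 1ℚ :+ con 0ℚ) :* y :- y := s) refl (∑ (suc j) c) (x ^ suc j) ⟩
  ∑ (suc j) c                                               ∎
  where
  c : ℕ → ℚ
  c i = ι (suc j C i) * x ^ i

toℚᵘ-ι : ∀ n → ℚ.toℚᵘ (ι n) ℚᵘ.≃ ℚᵘ.mkℚᵘ (ℤ.+ n) 0
toℚᵘ-ι zero    = ℚᵘ.*≡* refl
toℚᵘ-ι (suc n) = ℚᵘP.≃-trans (ℚP.toℚᵘ-homo-+ 1ℚ (ι n))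
  (ℚᵘP.≃-trans (ℚᵘP.+-congʳ (ℚ.toℚᵘ 1ℚ) (toℚᵘ-ι n)) (ℚᵘ.*≡* (cong (λ m → (ℤ.+ 1 ℤ.+ m) ℤ.* ℤ.+ 1) (ℤP.*-identityʳ (ℤ.+ n)))))

[1/n]*n≡1 : ∀ n .{{_ : ℕ.NonZero n}} → ℤ.+ 1 ℚ./ n * ι n ≡ 1ℚ
[1/n]*n≡1 n = ℚP.toℚᵘ-injective (ℚᵘP.≃-trans (ℚP.toℚᵘ-homo-* q (ι n))
  (ℚᵘP.≃-trans (ℚᵘP.*-congˡ {ℚ.toℚᵘ q} (toℚᵘ-ι n)) (cross q ↥q≡1 ↧q≡n)))
  where
  q = ℤ.+ 1 ℚ./ n
  gcd[1,n]≡1 : GCD.gcd 1 n ≡ 1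
  gcd[1,n]≡1 = ℕD.∣1⇒≡1 (GCD.gcd[m,n]∣m 1 n)
  ↥q≡1 : ℚ.↥ q ≡ ℤ.+ 1
  ↥q≡1 = trans (sym (ℤP.*-identityʳ _)) (trans (cong (λ g → ℚ.↥ q ℤ.* ℤ.+ g) (sym gcd[1,n]≡1)) (ℚP.↥-/ (ℤ.+ 1) n))
  ↧q≡n : ℚ.↧ q ≡ ℤ.+ n
  ↧q≡n = trans (sym (ℤP.*-identityʳ _)) (trans (cong (λ g → ℚ.↧ q ℤ.* ℤ.+ g) (sym gcd[1,n]≡1)) (ℚP.↧-/ (ℤ.+ 1) n))
  cross : ∀ r → ℚ.↥ r ≡ ℤ.+ 1 → ℚ.↧ r ≡ ℤ.+ n → ℚ.toℚᵘ r ℚᵘ.* ℚᵘ.mkℚᵘ (ℤ.+ n) 0 ℚᵘ.≃ ℚ.toℚᵘ 1ℚ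
  cross (ℚ.mkℚ _ d-1 _) refl refl = ℚᵘ.*≡* (ℤP.*-assoc (ℤ.+ 1) (ℤ.+ suc d-1) (ℤ.+ 1))

cross-multiply : ∀ x b P a c → x * ι b ≡ ι P * (ι a - ι c) →
                 ℚ.↥ x ℤ.* ℤ.+ b ≡ ℤ.+ P ℤ.* (ℤ.+ a ℤ.- ℤ.+ c) ℤ.* ℚ.↧ x
cross-multiply x@(ℚ.mkℚ n d-1 _) b P a c eq with as-ℚᵘ
  where
  open ℚᵘP.≃-Reasoning using (step-≈-⟩) renaming (begin_ to begin-≃_; _∎ to _∎≃)
  ⌜_⌝ : ℕ → ℚᵘ.ℚᵘ
  ⌜ m ⌝ = ℚᵘ.mkℚᵘ (ℤ.+ m) 0
  as-ℚᵘ : ℚᵘ.mkℚᵘ n d-1 ℚᵘ.* ⌜ b ⌝ ℚᵘ.≃ ⌜ P ⌝ ℚᵘ.* (⌜ a ⌝ ℚᵘ.+ ℚᵘ.- ⌜ c ⌝)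
  as-ℚᵘ = begin-≃
    ℚ.toℚᵘ x ℚᵘ.* ⌜ b ⌝                              ≈⟨ ℚᵘP.*-congˡ {ℚ.toℚᵘ x} (ℚᵘP.≃-sym (toℚᵘ-ι b)) ⟩
    ℚ.toℚᵘ x ℚᵘ.* ℚ.toℚᵘ (ι b)                      ≈⟨ ℚᵘP.≃-sym (ℚP.toℚᵘ-homo-* x (ι b)) ⟩
    ℚ.toℚᵘ (x * ι b)                                ≈⟨ ℚP.toℚᵘ-cong eq ⟩
    ℚ.toℚᵘ (ι P * (ι a - ι c))                      ≈⟨ ℚP.toℚᵘ-homo-* (ι P) (ι a - ι c) ⟩
    ℚ.toℚᵘ (ι P) ℚᵘ.* ℚ.toℚᵘ (ι a - ι c)            ≈⟨ ℚᵘP.*-cong (toℚᵘ-ι P) (ℚP.toℚᵘ-homo-+ (ι a) (- ι c)) ⟩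
    ⌜ P ⌝ ℚᵘ.* (ℚ.toℚᵘ (ι a) ℚᵘ.+ ℚ.toℚᵘ (- ι c))
      ≈⟨ ℚᵘP.*-congˡ {⌜ P ⌝} (ℚᵘP.+-cong (toℚᵘ-ι a) (ℚᵘP.≃-trans (ℚP.toℚᵘ-homo‿- (ι c)) (ℚᵘP.-‿cong (toℚᵘ-ι c)))) ⟩
    ⌜ P ⌝ ℚᵘ.* (⌜ a ⌝ ℚᵘ.+ ℚᵘ.- ⌜ c ⌝)              ∎≃
... | ℚᵘ.*≡* e = trans (normalise₁ n (ℤ.+ b)) (trans e (normalise₂ (ℤ.+ P) (ℤ.+ a) (ℤ.+ c) (ℤ.+ suc d-1)))
  where
  normalise₁ : ∀ n b → n ℤ.* b ≡ (n ℤ.* b) ℤ.* (ℤ.+ 1 ℤ.* (ℤ.+ 1 ℤ.* ℤ.+ 1))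
  normalise₁ = ℤsolve-∀
  normalise₂ : ∀ P a c d → (P ℤ.* (a ℤ.* ℤ.+ 1 ℤ.+ (ℤ.- c) ℤ.* ℤ.+ 1)) ℤ.* (d ℤ.* ℤ.+ 1) ≡ P ℤ.* (a ℤ.- c) ℤ.* d
  normalise₂ = ℤsolve-∀

invPow-inverse : ∀ j s → invPow (suc j) s * ι (suc j) ^ s ≡ 1ℚ
invPow-inverse j s = trans (cong (invPow (suc j) s *_) (sym (ι-^ (suc j) s))) ([1/n]*n≡1 (suc j ℕ.^ s))
  where instance _ = ℕP.m^n≢0 (suc j) s

invPow-inverse₁ : ∀ j → invPow (suc j) 1 * ι (suc j) ≡ 1ℚ
invPow-inverse₁ j = trans (cong (invPow (suc j) 1 *_) (sym (ℚP.*-identityʳ (ι (suc j))))) (invPow-inverse j 1)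

inverse-unique : ∀ {a b c} → a * c ≡ 1ℚ → b * c ≡ 1ℚ → a ≡ b
inverse-unique {a} {b} {c} ac≡1 bc≡1 = begin
  a             ≡⟨ sym (ℚP.*-identityʳ a) ⟩
  a * 1ℚ        ≡⟨ cong (a *_) (sym bc≡1) ⟩
  a * (b * c)   ≡⟨ solve 3 (λ a b c → a :* (b :* c) := b :* (a :* c)) refl a b c ⟩
  b * (a * c)   ≡⟨ cong (b *_) ac≡1 ⟩
  b * 1ℚ        ≡⟨ ℚP.*-identityʳ b ⟩
  b             ∎

invPow-^ : ∀ j s → invPow (suc j) s ≡ invPow (suc j) 1 ^ s
invPow-^ j s = inverse-unique (invPow-inverse j s) (begin
  invPow (suc j) 1 ^ s * ι (suc j) ^ s   ≡⟨ sym (^-distrib-* (invPow (suc j) 1) (ι (suc j)) s) ⟩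
  (invPow (suc j) 1 * ι (suc j)) ^ s     ≡⟨ cong (_^ s) (invPow-inverse₁ j) ⟩
  1ℚ ^ s                                 ≡⟨ ^-identity s ⟩
  1ℚ                                     ∎)
  where
  ^-identity : ∀ s → 1ℚ ^ s ≡ 1ℚ
  ^-identity zero    = refl
  ^-identity (suc s) = trans (ℚP.*-identityˡ (1ℚ ^ s)) (^-identity s)

-- ℤ₍ₚ₎ and p-adic valuations

module Valuation {p : ℕ} (p-prime : Prime p) where

  instance
    p≢0 : ℕ.NonZero p
    p≢0 = prime⇒nonZero p-prime

  1<p : 1 < p
  1<p = ℕ.nonTrivial⇒n>1 p {{prime⇒nonTrivial p-prime}}

  p∤1 : p ∤ 1
  p∤1 p∣1 = ℕP.<-irrefl (sym (ℕD.∣1⇒≡1 p∣1)) 1<p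

  p∤* : ∀ {a b} → p ∤ a → p ∤ b → p ∤ a ℕ.* b
  p∤* {a} {b} p∤a p∤b p∣ab = [ p∤a , p∤b ] (euclidsLemma a b p-prime p∣ab)

  p∤^ : ∀ {a} n → p ∤ a → p ∤ a ℕ.^ n
  p∤^ zero    p∤a = p∤1
  p∤^ (suc n) p∤a = p∤* p∤a (p∤^ n p∤a)

  p∤-small : ∀ {k} → 0 < k → k < p → p ∤ k
  p∤-small 0<k k<p p∣k = ℕP.<⇒≱ k<p (ℕD.∣⇒≤ {{ℕ.>-nonZero 0<k}} p∣k)

  p∤⇒coprime : ∀ {n} → p ∤ n → Coprime n p
  p∤⇒coprime p∤n (d∣n , d∣p) with prime⇒irreducible p-prime d∣p
  ... | inj₁ d≡1 = d≡1
  ... | inj₂ refl = ⊥-elim (p∤n d∣n)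

  coprime⇒p∤ : ∀ {n} → Coprime n p → p ∤ n
  coprime⇒p∤ n⊥p p∣n = ℕP.<-irrefl (sym (n⊥p (p∣n , ℕD.∣-refl))) 1<p

  p^[1+a]∣⇒p∣ : ∀ a {n} → p ℕ.^ suc a ∣ n → p ∣ n
  p^[1+a]∣⇒p∣ a = ℕD.∣-trans (ℕD.m∣m*n (p ℕ.^ a))

  p^r∣b*n⇒p^r∣n : ∀ r {b n} → p ∤ b → p ℕ.^ r ∣ b ℕ.* n → p ℕ.^ r ∣ n
  p^r∣b*n⇒p^r∣n zero    {n = n} _   _ = ℕD.1∣ n
  p^r∣b*n⇒p^r∣n (suc r) {b} {n} p∤b p^r∣bn
    with euclidsLemma b n p-prime (ℕD.∣-trans (ℕD.m∣m*n (p ℕ.^ r)) p^r∣bn)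
  ... | inj₁ p∣b = ⊥-elim (p∤b p∣b)
  ... | inj₂ (divides n′ refl) = subst (_∣ n′ ℕ.* p) (ℕP.*-comm (p ℕ.^ r) p)
    (ℕD.*-monoˡ-∣ p (p^r∣b*n⇒p^r∣n r p∤b (ℕD.*-cancelˡ-∣ p (subst (p ℕ.* p ℕ.^ r ∣_) (reassoc b n′ p) p^r∣bn))))
    where
    reassoc : ∀ b n′ p → b ℕ.* (n′ ℕ.* p) ≡ p ℕ.* (b ℕ.* n′)
    reassoc = solve-∀

  -- Membership in ℤ₍ₚ₎, with the numerator written as a difference of two naturals.
  record Integral (x : ℚ) : Set where
    constructor integral
    field
      denominator numerator⁺ numerator⁻ : ℕ
      p∤denominator : p ∤ denominator
      x*denominator : x * ι denominator ≡ ι numerator⁺ - ι numerator⁻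

  integral-ι : ∀ n → Integral (ι n)
  integral-ι n = integral 1 n 0 p∤1 (solve 1 (λ a → a :* (con 1ℚ :+ con 0ℚ) := a :- con 0ℚ) refl (ι n))

  integral-+ : ∀ {x y} → Integral x → Integral y → Integral (x + y)
  integral-+ {x} {y} (integral b₁ a₁ c₁ p∤b₁ e₁) (integral b₂ a₂ c₂ p∤b₂ e₂) =
    integral (b₁ ℕ.* b₂) (a₁ ℕ.* b₂ ℕ.+ a₂ ℕ.* b₁) (c₁ ℕ.* b₂ ℕ.+ c₂ ℕ.* b₁) (p∤* p∤b₁ p∤b₂) (begin
      (x + y) * ι (b₁ ℕ.* b₂)                              ≡⟨ cong ((x + y) *_) (ι-* b₁ b₂) ⟩
      (x + y) * (ι b₁ * ι b₂)                              ≡⟨ solve 4 (λ x y u v → (x :+ y) :* (u :* v) := (x :* u) :* v :+ (y :* v) :* u) refl x y (ι b₁) (ι b₂) ⟩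
      (x * ι b₁) * ι b₂ + (y * ι b₂) * ι b₁                ≡⟨ cong₂ (λ s t → s * ι b₂ + t * ι b₁) e₁ e₂ ⟩
      (ι a₁ - ι c₁) * ι b₂ + (ι a₂ - ι c₂) * ι b₁
        ≡⟨ solve 6 (λ a₁ c₁ a₂ c₂ u v → (a₁ :- c₁) :* v :+ (a₂ :- c₂) :* u := (a₁ :* v :+ a₂ :* u) :- (c₁ :* v :+ c₂ :* u))
             refl (ι a₁) (ι c₁) (ι a₂) (ι c₂) (ι b₁) (ι b₂) ⟩
      (ι a₁ * ι b₂ + ι a₂ * ι b₁) - (ι c₁ * ι b₂ + ι c₂ * ι b₁)   ≡⟨ sym (cong₂ _-_ (ι-*+* a₁ b₂ a₂ b₁) (ι-*+* c₁ b₂ c₂ b₁)) ⟩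
      ι (a₁ ℕ.* b₂ ℕ.+ a₂ ℕ.* b₁) - ι (c₁ ℕ.* b₂ ℕ.+ c₂ ℕ.* b₁)   ∎)

  integral-* : ∀ {x y} → Integral x → Integral y → Integral (x * y)
  integral-* {x} {y} (integral b₁ a₁ c₁ p∤b₁ e₁) (integral b₂ a₂ c₂ p∤b₂ e₂) =
    integral (b₁ ℕ.* b₂) (a₁ ℕ.* a₂ ℕ.+ c₁ ℕ.* c₂) (a₁ ℕ.* c₂ ℕ.+ c₁ ℕ.* a₂) (p∤* p∤b₁ p∤b₂) (begin
      (x * y) * ι (b₁ ℕ.* b₂)                              ≡⟨ cong ((x * y) *_) (ι-* b₁ b₂) ⟩
      (x * y) * (ι b₁ * ι b₂)                              ≡⟨ solve 4 (λ x y u v → (x :* y) :* (u :* v) := (x :* u) :* (y :* v)) refl x y (ι b₁) (ι b₂) ⟩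
      (x * ι b₁) * (y * ι b₂)                              ≡⟨ cong₂ _*_ e₁ e₂ ⟩
      (ι a₁ - ι c₁) * (ι a₂ - ι c₂)
        ≡⟨ solve 4 (λ a₁ c₁ a₂ c₂ → (a₁ :- c₁) :* (a₂ :- c₂) := (a₁ :* a₂ :+ c₁ :* c₂) :- (a₁ :* c₂ :+ c₁ :* a₂))
             refl (ι a₁) (ι c₁) (ι a₂) (ι c₂) ⟩
      (ι a₁ * ι a₂ + ι c₁ * ι c₂) - (ι a₁ * ι c₂ + ι c₁ * ι a₂)   ≡⟨ sym (cong₂ _-_ (ι-*+* a₁ a₂ c₁ c₂) (ι-*+* a₁ c₂ c₁ a₂)) ⟩
      ι (a₁ ℕ.* a₂ ℕ.+ c₁ ℕ.* c₂) - ι (a₁ ℕ.* c₂ ℕ.+ c₁ ℕ.* a₂)   ∎)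

  integral-neg : ∀ {x} → Integral x → Integral (- x)
  integral-neg {x} (integral b a c p∤b e) = integral b c a p∤b (begin
    (- x) * ι b     ≡⟨ solve 2 (λ x u → (:- x) :* u := :- (x :* u)) refl x (ι b) ⟩
    - (x * ι b)     ≡⟨ cong -_ e ⟩
    - (ι a - ι c)   ≡⟨ solve 2 (λ a c → :- (a :- c) := c :- a) refl (ι a) (ι c) ⟩
    ι c - ι a       ∎)

  integral-^ : ∀ {x} n → Integral x → Integral (x ^ n)
  integral-^ zero    _     = integral-ι 1
  integral-^ (suc n) x-int = integral-* x-int (integral-^ n x-int)

  integral-∑ : ∀ f n → (∀ k → Integral (f k)) → Integral (∑ n f)
  integral-∑ f zero    _     = integral-ι 0
  integral-∑ f (suc n) f-int = integral-+ (integral-∑ f n f-int) (f-int n)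

  integral-invPow : ∀ j s → p ∤ suc j → Integral (invPow (suc j) s)
  integral-invPow j s p∤k = integral (suc j ℕ.^ s) 1 0 (p∤^ s p∤k) (begin
    invPow (suc j) s * ι (suc j ℕ.^ s)   ≡⟨ cong (invPow (suc j) s *_) (ι-^ (suc j) s) ⟩
    invPow (suc j) s * ι (suc j) ^ s     ≡⟨ invPow-inverse j s ⟩
    1ℚ                                   ≡⟨ solve 0 (con 1ℚ := (con 1ℚ :+ con 0ℚ) :- con 0ℚ) refl ⟩
    ι 1 - ι 0                            ∎)

  -- r ≤ᵥ x reads r ≤ vₚ(x).
  infix 4 _≤ᵥ_
  record _≤ᵥ_ (r : ℕ) (x : ℚ) : Set where
    constructor mk≤ᵥ
    field
      cofactor : ℚ
      integral-cofactor : Integral cofactor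
      x≡pʳ*cofactor : x ≡ ι (p ℕ.^ r) * cofactor

  ι-p^-+ : ∀ r s → ι (p ℕ.^ (r ℕ.+ s)) ≡ ι (p ℕ.^ r) * ι (p ℕ.^ s)
  ι-p^-+ r s = trans (cong ι (ℕP.^-distribˡ-+-* p r s)) (ι-* (p ℕ.^ r) (p ℕ.^ s))

  ≤ᵥ-0 : ∀ r → r ≤ᵥ 0ℚ
  ≤ᵥ-0 r = mk≤ᵥ 0ℚ (integral-ι 0) (sym (ℚP.*-zeroʳ (ι (p ℕ.^ r))))

  ≤ᵥ-+ : ∀ {r x y} → r ≤ᵥ x → r ≤ᵥ y → r ≤ᵥ x + y
  ≤ᵥ-+ {r} (mk≤ᵥ a a-int refl) (mk≤ᵥ b b-int refl) =
    mk≤ᵥ (a + b) (integral-+ a-int b-int) (sym (ℚP.*-distribˡ-+ (ι (p ℕ.^ r)) a b))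

  ≤ᵥ-*ˡ : ∀ {r x z} → Integral z → r ≤ᵥ x → r ≤ᵥ z * x
  ≤ᵥ-*ˡ {r} {z = z} z-int (mk≤ᵥ a a-int refl) =
    mk≤ᵥ (z * a) (integral-* z-int a-int) (solve 3 (λ z q a → z :* (q :* a) := q :* (z :* a)) refl z (ι (p ℕ.^ r)) a)

  ≤ᵥ-*ʳ : ∀ {r x z} → Integral z → r ≤ᵥ x → r ≤ᵥ x * z
  ≤ᵥ-*ʳ {r} {x} {z} z-int x-val = subst (r ≤ᵥ_) (ℚP.*-comm z x) (≤ᵥ-*ˡ z-int x-val)

  ≤ᵥ-neg : ∀ {r x} → r ≤ᵥ x → r ≤ᵥ - x
  ≤ᵥ-neg {r} (mk≤ᵥ a a-int refl) =
    mk≤ᵥ (- a) (integral-neg a-int) (solve 2 (λ q a → :- (q :* a) := q :* (:- a)) refl (ι (p ℕ.^ r)) a)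

  ≤ᵥ-sub : ∀ {r x y} → r ≤ᵥ x → r ≤ᵥ y → r ≤ᵥ x - y
  ≤ᵥ-sub x-val y-val = ≤ᵥ-+ x-val (≤ᵥ-neg y-val)

  ≤ᵥ-* : ∀ {r s x y} → r ≤ᵥ x → s ≤ᵥ y → r ℕ.+ s ≤ᵥ x * y
  ≤ᵥ-* {r} {s} (mk≤ᵥ a a-int refl) (mk≤ᵥ b b-int refl) = mk≤ᵥ (a * b) (integral-* a-int b-int) (begin
    ι (p ℕ.^ r) * a * (ι (p ℕ.^ s) * b)      ≡⟨ solve 4 (λ u v a b → u :* a :* (v :* b) := u :* v :* (a :* b)) refl (ι (p ℕ.^ r)) (ι (p ℕ.^ s)) a b ⟩
    ι (p ℕ.^ r) * ι (p ℕ.^ s) * (a * b)      ≡⟨ cong (_* (a * b)) (sym (ι-p^-+ r s)) ⟩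
    ι (p ℕ.^ (r ℕ.+ s)) * (a * b)            ∎)

  integral⇒0≤ᵥ : ∀ {x} → Integral x → 0 ≤ᵥ x
  integral⇒0≤ᵥ {x} x-int = mk≤ᵥ x x-int (sym (ℚP.*-identityˡ x))

  ≤ᵥ⇒integral : ∀ {r x} → r ≤ᵥ x → Integral x
  ≤ᵥ⇒integral {r} (mk≤ᵥ a a-int refl) = integral-* (integral-ι (p ℕ.^ r)) a-int

  ≤ᵥ-weaken : ∀ {r s x} → r ≤ s → s ≤ᵥ x → r ≤ᵥ x
  ≤ᵥ-weaken {r} {s} r≤s (mk≤ᵥ a a-int refl) =
    mk≤ᵥ (ι (p ℕ.^ (s ℕ.∸ r)) * a) (integral-* (integral-ι (p ℕ.^ (s ℕ.∸ r))) a-int) (begin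
      ι (p ℕ.^ s) * a                              ≡⟨ cong (λ t → ι (p ℕ.^ t) * a) (sym (ℕP.m+[n∸m]≡n r≤s)) ⟩
      ι (p ℕ.^ (r ℕ.+ (s ℕ.∸ r))) * a              ≡⟨ cong (_* a) (ι-p^-+ r (s ℕ.∸ r)) ⟩
      ι (p ℕ.^ r) * ι (p ℕ.^ (s ℕ.∸ r)) * a        ≡⟨ ℚP.*-assoc (ι (p ℕ.^ r)) _ a ⟩
      ι (p ℕ.^ r) * (ι (p ℕ.^ (s ℕ.∸ r)) * a)      ∎)

  ≤ᵥ-ι : ∀ {r n} → p ℕ.^ r ∣ n → r ≤ᵥ ι n
  ≤ᵥ-ι {r} (divides q refl) = mk≤ᵥ (ι q) (integral-ι q) (trans (ι-* q (p ℕ.^ r)) (ℚP.*-comm (ι q) _))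

  1≤ᵥι : ∀ {n} → p ∣ n → 1 ≤ᵥ ι n
  1≤ᵥι p∣n = ≤ᵥ-ι (subst (_∣ _) (sym (ℕP.*-identityʳ p)) p∣n)

  ≤ᵥ-∑ : ∀ {r} f n → (∀ k → k < n → r ≤ᵥ f k) → r ≤ᵥ ∑ n f
  ≤ᵥ-∑ f zero    _     = ≤ᵥ-0 _
  ≤ᵥ-∑ f (suc n) f-val = ≤ᵥ-+ (≤ᵥ-∑ f n (λ k k<n → f-val k (ℕP.m<n⇒m<1+n k<n))) (f-val n ℕP.≤-refl)

  ≤ᵥ-cancel-unit : ∀ {r x} j → p ∤ suc j → r ≤ᵥ ι (suc j) * x → r ≤ᵥ x
  ≤ᵥ-cancel-unit {r} {x} j p∤k kx-val = subst (r ≤ᵥ_) cancel (≤ᵥ-*ˡ (integral-invPow j 1 p∤k) kx-val)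
    where
    cancel : invPow (suc j) 1 * (ι (suc j) * x) ≡ x
    cancel = begin
      invPow (suc j) 1 * (ι (suc j) * x)   ≡⟨ sym (ℚP.*-assoc (invPow (suc j) 1) (ι (suc j)) x) ⟩
      invPow (suc j) 1 * ι (suc j) * x     ≡⟨ cong (_* x) (invPow-inverse₁ j) ⟩
      1ℚ * x                               ≡⟨ ℚP.*-identityˡ x ⟩
      x                                    ∎

  ≤ᵥ-^-1 : ∀ {r x} → Integral x → r ≤ᵥ x - 1ℚ → ∀ c → r ≤ᵥ x ^ c - 1ℚ
  ≤ᵥ-^-1 {r} {x} x-int x-1-val zero    = subst (r ≤ᵥ_) (sym (ℚP.+-inverseʳ 1ℚ)) (≤ᵥ-0 r)
  ≤ᵥ-^-1 {r} {x} x-int x-1-val (suc c) = subst (r ≤ᵥ_) (sym factor)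
    (≤ᵥ-+ (≤ᵥ-*ʳ (integral-^ c x-int) x-1-val) (≤ᵥ-^-1 x-int x-1-val c))
    where
    factor : x * x ^ c - 1ℚ ≡ (x - 1ℚ) * x ^ c + (x ^ c - 1ℚ)
    factor = solve 2 (λ x y → x :* y :- con 1ℚ := (x :- con 1ℚ) :* y :+ (y :- con 1ℚ)) refl x (x ^ c)

  ≤ᵥ⇒≡0modPow : ∀ {r x} → r ≤ᵥ x → ≡0modPow p r x
  ≤ᵥ⇒≡0modPow {r} {x@(ℚ.mkℚ n d-1 n⊥d)} (mk≤ᵥ y (integral b a c p∤b y*b) x≡pʳy) = p∤⇒coprime p∤d , pʳ∣∣n∣
    where
    pʳ = p ℕ.^ r
    q = ℤ.∣ ℤ.+ a ℤ.- ℤ.+ c ∣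
    x*b : x * ι b ≡ ι pʳ * (ι a - ι c)
    x*b = trans (cong (_* ι b) x≡pʳy) (trans (ℚP.*-assoc (ι pʳ) y (ι b)) (cong (ι pʳ *_) y*b))
    ∣n∣*b : ℤ.∣ n ∣ ℕ.* b ≡ pʳ ℕ.* q ℕ.* suc d-1
    ∣n∣*b = begin
      ℤ.∣ n ∣ ℕ.* b                                            ≡⟨ sym (ℤP.abs-* n (ℤ.+ b)) ⟩
      ℤ.∣ n ℤ.* ℤ.+ b ∣                                        ≡⟨ cong ℤ.∣_∣ (cross-multiply x b pʳ a c x*b) ⟩
      ℤ.∣ ℤ.+ pʳ ℤ.* (ℤ.+ a ℤ.- ℤ.+ c) ℤ.* ℤ.+ suc d-1 ∣       ≡⟨ ℤP.abs-* (ℤ.+ pʳ ℤ.* (ℤ.+ a ℤ.- ℤ.+ c)) (ℤ.+ suc d-1) ⟩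
      ℤ.∣ ℤ.+ pʳ ℤ.* (ℤ.+ a ℤ.- ℤ.+ c) ∣ ℕ.* suc d-1           ≡⟨ cong (ℕ._* suc d-1) (ℤP.abs-* (ℤ.+ pʳ) (ℤ.+ a ℤ.- ℤ.+ c)) ⟩
      pʳ ℕ.* q ℕ.* suc d-1                                     ∎
    d∣b : suc d-1 ∣ b
    d∣b = Coprime.coprime-divisor (Coprime.sym (Coprime.recompute n⊥d)) (divides (pʳ ℕ.* q) ∣n∣*b)
    p∤d : p ∤ suc d-1
    p∤d p∣d = p∤b (ℕD.∣-trans p∣d d∣b)
    pʳ∣∣n∣ : pʳ ∣ ℤ.∣ n ∣
    pʳ∣∣n∣ = p^r∣b*n⇒p^r∣n r p∤b (divides (q ℕ.* suc d-1) (begin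
      b ℕ.* ℤ.∣ n ∣             ≡⟨ ℕP.*-comm b ℤ.∣ n ∣ ⟩
      ℤ.∣ n ∣ ℕ.* b             ≡⟨ ∣n∣*b ⟩
      pʳ ℕ.* q ℕ.* suc d-1      ≡⟨ rearrange pʳ q (suc d-1) ⟩
      q ℕ.* suc d-1 ℕ.* pʳ      ∎))
      where
      rearrange : ∀ a b c → a ℕ.* b ℕ.* c ≡ b ℕ.* c ℕ.* a
      rearrange = solve-∀

  reciprocal-power-expansion : ∀ {a X Y u v} → Integral X → Integral Y → X * u ≡ 1ℚ → Y * v ≡ 1ℚ →
    a ≤ᵥ v - u → ∀ e → a ℕ.+ a ≤ᵥ Y ^ e - X ^ e + ι e * (v - u) * X ^ suc e
  reciprocal-power-expansion {a} {X} {Y} {u} {v} X-int Y-int Xu≡1 Yv≡1 t-val = expansion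
    where
    t = v - u
    tXY≡X-Y : t * X * Y ≡ X - Y
    tXY≡X-Y = begin
      t * X * Y                   ≡⟨ solve 4 (λ u v X Y → (v :- u) :* X :* Y := X :* (Y :* v) :- Y :* (X :* u)) refl u v X Y ⟩
      X * (Y * v) - Y * (X * u)   ≡⟨ cong₂ (λ s w → X * s - Y * w) Yv≡1 Xu≡1 ⟩
      X * 1ℚ - Y * 1ℚ             ≡⟨ cong₂ _-_ (ℚP.*-identityʳ X) (ℚP.*-identityʳ Y) ⟩
      X - Y                       ∎
    tX-val : a ≤ᵥ t * X
    tX-val = ≤ᵥ-*ʳ X-int t-val
    D₁-val : a ℕ.+ a ≤ᵥ Y - X + t * X * X
    D₁-val = subst (a ℕ.+ a ≤ᵥ_) (begin
      (t * X) * (t * X * Y)       ≡⟨ cong ((t * X) *_) tXY≡X-Y ⟩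
      (t * X) * (X - Y)           ≡⟨ solve 3 (λ t X Y → (t :* X) :* (X :- Y) := t :* X :* X :- t :* X :* Y) refl t X Y ⟩
      t * X * X - t * X * Y       ≡⟨ cong (λ w → t * X * X - w) tXY≡X-Y ⟩
      t * X * X - (X - Y)         ≡⟨ solve 3 (λ t X Y → t :* X :* X :- (X :- Y) := Y :- X :+ t :* X :* X) refl t X Y ⟩
      Y - X + t * X * X           ∎) (≤ᵥ-* tX-val (≤ᵥ-*ʳ Y-int tX-val))
    expansion : ∀ e → a ℕ.+ a ≤ᵥ Y ^ e - X ^ e + ι e * t * X ^ suc e
    expansion zero    = subst (a ℕ.+ a ≤ᵥ_)
      (solve 2 (λ t X → con 0ℚ := con 1ℚ :- con 1ℚ :+ con 0ℚ :* t :* (X :* con 1ℚ)) refl t X) (≤ᵥ-0 _)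
    expansion (suc e) = subst (a ℕ.+ a ≤ᵥ_) (sym step)
      (≤ᵥ-+ (≤ᵥ-+ (≤ᵥ-sub (≤ᵥ-*ˡ X-int (expansion e)) (≤ᵥ-*ˡ (integral-* (integral-* (≤ᵥ⇒integral t-val) X-int) X-int) (expansion e)))
                  (≤ᵥ-*ʳ (integral-^ e Y-int) D₁-val))
            (≤ᵥ-*ʳ (integral-* X-int (integral-^ e X-int)) (≤ᵥ-* (≤ᵥ-*ˡ (integral-ι e) tX-val) tX-val)))
      where
      -- Dₑ₊₁ = (X − t X²) Dₑ + D₁ Yᵉ + e (t X)² Xᵉ⁺¹, and each summand has valuation ≥ 2a.
      Dₑ = Y ^ e - X ^ e + ι e * t * (X * X ^ e)
      step : Y * Y ^ e - X * X ^ e + (1ℚ + ι e) * t * (X * (X * X ^ e))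
           ≡ X * Dₑ - t * X * X * Dₑ + (Y - X + t * X * X) * Y ^ e + ι e * (t * X) * (t * X) * (X * X ^ e)
      step = solve 6 (λ Y B X A E t →
        Y :* B :- X :* A :+ (con 1ℚ :+ E) :* t :* (X :* (X :* A)) :=
        X :* (B :- A :+ E :* t :* (X :* A)) :- t :* X :* X :* (B :- A :+ E :* t :* (X :* A))
          :+ (Y :- X :+ t :* X :* X) :* B :+ E :* (t :* X) :* (t :* X) :* (X :* A)) refl Y (Y ^ e) X (X ^ e) (ι e) t

  -- Fermat's little theorem and power sums

  p-1 : ℕ
  p-1 = p ℕ.∸ 1

  suc[p-1]≡p : suc p-1 ≡ p
  suc[p-1]≡p = ℕP.m+[n∸m]≡n (ℕP.<⇒≤ 1<p)

  fermat : ∀ k → 1 ≤ᵥ ι k ^ p - ι k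
  fermat k = subst (λ n → 1 ≤ᵥ ι k ^ n - ι k) suc[p-1]≡p (fermat′ k)
    where
    fermat′ : ∀ k → 1 ≤ᵥ ι k ^ suc p-1 - ι k
    fermat′ zero    = subst (1 ≤ᵥ_) (sym (trans (cong (_- 0ℚ) (ℚP.*-zeroˡ (ι 0 ^ p-1))) (ℚP.+-inverseʳ 0ℚ))) (≤ᵥ-0 1)
    fermat′ (suc k) = subst (1 ≤ᵥ_) (sym expand) (≤ᵥ-+ (fermat′ k) (≤ᵥ-∑ (λ i → c (suc i)) p-1 middle-val))
      where
      x = ι k
      c : ℕ → ℚ
      c i = ι (suc p-1 C i) * x ^ i
      middle = ∑[ i < p-1 ] c (suc i)
      middle-val : ∀ i → i < p-1 → 1 ≤ᵥ c (suc i)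
      middle-val i i<p-1 = ≤ᵥ-*ʳ (integral-^ (suc i) (integral-ι k)) (1≤ᵥι (subst (λ n → p ∣ n C suc i) (sym suc[p-1]≡p)
        (prime∣pCk p-prime (s≤s z≤n) (subst (suc (suc i) ≤_) suc[p-1]≡p (s≤s i<p-1)))))
      expand : ι (suc k) ^ suc p-1 - ι (suc k) ≡ (x ^ suc p-1 - x) + middle
      expand = begin
        (1ℚ + x) ^ suc p-1 - (1ℚ + x)                         ≡⟨ cong (_- (1ℚ + x)) (trans (binomial x (suc p-1)) (∑-shift c (suc p-1))) ⟩
        c 0 + (middle + c (suc p-1)) - (1ℚ + x)               ≡⟨ cong (λ m → c 0 + (middle + ι m * x ^ suc p-1) - (1ℚ + x)) (nCn≡1 (suc p-1)) ⟩
        ι 1 * 1ℚ + (middle + ι 1 * x ^ suc p-1) - (1ℚ + x)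
          ≡⟨ solve 3 (λ M y x → (con 1ℚ :+ con 0ℚ) :* con 1ℚ :+ (M :+ (con 1ℚ :+ con 0ℚ) :* y) :- (con 1ℚ :+ x) := (y :- x) :+ M)
               refl middle (x ^ suc p-1) x ⟩
        (x ^ suc p-1 - x) + middle                            ∎

  fermat-unit : ∀ j → p ∤ suc j → 1 ≤ᵥ ι (suc j) ^ p-1 - 1ℚ
  fermat-unit j p∤k = subst (1 ≤ᵥ_) divide (≤ᵥ-*ˡ (integral-invPow j 1 p∤k) (fermat (suc j)))
    where
    x = ι (suc j)
    a = invPow (suc j) 1
    divide : a * (x ^ p - x) ≡ x ^ p-1 - 1ℚ
    divide = begin
      a * (x ^ p - x)                ≡⟨ cong (λ n → a * (x ^ n - x)) (sym suc[p-1]≡p) ⟩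
      a * (x * x ^ p-1 - x)          ≡⟨ solve 3 (λ a x y → a :* (x :* y :- x) := (a :* x) :* y :- a :* x) refl a x (x ^ p-1) ⟩
      (a * x) * x ^ p-1 - a * x      ≡⟨ cong (λ z → z * x ^ p-1 - z) (invPow-inverse₁ j) ⟩
      1ℚ * x ^ p-1 - 1ℚ              ≡⟨ cong (_- 1ℚ) (ℚP.*-identityˡ (x ^ p-1)) ⟩
      x ^ p-1 - 1ℚ                   ∎

  fermat-unit-^ : ∀ j → p ∤ suc j → ∀ c → 1 ≤ᵥ ι (suc j) ^ (p-1 ℕ.* c) - 1ℚ
  fermat-unit-^ j p∤k c = subst (λ z → 1 ≤ᵥ z - 1ℚ) (^-assocʳ (ι (suc j)) p-1 c)
    (≤ᵥ-^-1 (integral-^ p-1 (integral-ι (suc j))) (fermat-unit j p∤k) c)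

  powerSum : ℕ → ℚ
  powerSum j = ∑[ k < p ] ι k ^ j

  binomial-powerSum : ∀ j → 1 ≤ᵥ ∑[ i < suc j ] (ι (suc j C i) * powerSum i)
  binomial-powerSum j = subst (1 ≤ᵥ_) (sym telescope)
    (≤ᵥ-sub (≤ᵥ-*ʳ (integral-^ j (integral-ι p)) (1≤ᵥι ℕD.∣-refl)) (subst (1 ≤ᵥ_) (sym (0^n≡0 (suc j) (λ ()))) (≤ᵥ-0 1)))
    where
    f : ℕ → ℚ
    f k = ι k ^ suc j
    telescope : ∑[ i < suc j ] (ι (suc j C i) * powerSum i) ≡ f p - f 0
    telescope = begin
      ∑[ i < suc j ] (ι (suc j C i) * powerSum i)           ≡⟨ ∑-cong (suc j) (λ i _ → sym (∑-*ˡ (ι (suc j C i)) (λ k → ι k ^ i) p)) ⟩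
      ∑[ i < suc j ] ∑[ k < p ] (ι (suc j C i) * ι k ^ i)   ≡⟨ ∑-comm (λ i k → ι (suc j C i) * ι k ^ i) (suc j) p ⟩
      ∑[ k < p ] ∑[ i < suc j ] (ι (suc j C i) * ι k ^ i)   ≡⟨ ∑-cong p (λ k _ → sym (binomial-difference (ι k) j)) ⟩
      ∑[ k < p ] (f (suc k) - f k)                          ≡⟨ ∑-telescope f p ⟩
      f p - f 0                                             ∎

  powerSum-small : ∀ j → suc j < p → 1 ≤ᵥ powerSum j
  powerSum-small = <-rec (λ j → suc j < p → 1 ≤ᵥ powerSum j) step
    where
    step : ∀ j → (∀ {i} → i < j → suc i < p → 1 ≤ᵥ powerSum i) → suc j < p → 1 ≤ᵥ powerSum j
    step j rec 1+j<p = ≤ᵥ-cancel-unit j (p∤-small (s≤s z≤n) 1+j<p)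
      (subst (1 ≤ᵥ_) isolate (≤ᵥ-sub (binomial-powerSum j) (≤ᵥ-∑ c j lower-val)))
      where
      c : ℕ → ℚ
      c i = ι (suc j C i) * powerSum i
      lower-val : ∀ i → i < j → 1 ≤ᵥ c i
      lower-val i i<j = ≤ᵥ-*ˡ (integral-ι (suc j C i)) (rec i<j (ℕP.<-trans (s≤s i<j) 1+j<p))
      isolate : ∑ j c + c j - ∑ j c ≡ ι (suc j) * powerSum j
      isolate = begin
        ∑ j c + c j - ∑ j c   ≡⟨ solve 2 (λ a b → a :+ b :- a := b) refl (∑ j c) (c j) ⟩
        c j                   ≡⟨ cong (λ m → ι m * powerSum j) ([1+n]Cn≡1+n j) ⟩
        ι (suc j) * powerSum j ∎

  powerSum-nonmultiple : ∀ j → p-1 ∤ j → 1 ≤ᵥ powerSum j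
  powerSum-nonmultiple j p-1∤j = subst (1 ≤ᵥ_) recombine
    (≤ᵥ-+ (≤ᵥ-∑ (λ k → ι k ^ j - ι k ^ j₀) p difference-val) (powerSum-small j₀ 1+j₀<p))
    where
    -- kʲ ≡ k^(j mod (p − 1)) for units k, and 0 < j mod (p − 1) < p − 1.
    instance
      p-1≢0 : ℕ.NonZero p-1
      p-1≢0 = ℕ.>-nonZero (ℕP.m<n⇒0<n∸m 1<p)
    j₀ = j % p-1
    c = j / p-1
    1+j₀<p : suc j₀ < p
    1+j₀<p = subst (suc j₀ <_) suc[p-1]≡p (s≤s (m%n<n j p-1))
    j₀≢0 : j₀ ≢ 0
    j₀≢0 j₀≡0 = p-1∤j (ℕD.m%n≡0⇒n∣m j p-1 j₀≡0)
    j≢0 : j ≢ 0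
    j≢0 refl = p-1∤j (p-1 ℕD.∣0)
    difference-val : ∀ k → k < p → 1 ≤ᵥ ι k ^ j - ι k ^ j₀
    difference-val zero    _   = subst (1 ≤ᵥ_)
      (sym (trans (cong₂ _-_ (0^n≡0 j j≢0) (0^n≡0 j₀ j₀≢0)) (ℚP.+-inverseʳ 0ℚ))) (≤ᵥ-0 1)
    difference-val (suc k) k<p = subst (1 ≤ᵥ_) (sym factor)
      (≤ᵥ-*ˡ (integral-^ j₀ (integral-ι (suc k))) (fermat-unit-^ k (p∤-small (s≤s z≤n) k<p) c))
      where
      x = ι (suc k)
      factor : x ^ j - x ^ j₀ ≡ x ^ j₀ * (x ^ (p-1 ℕ.* c) - 1ℚ)
      factor = begin
        x ^ j - x ^ j₀                          ≡⟨ cong (λ n → x ^ n - x ^ j₀) (trans (m≡m%n+[m/n]*n j p-1) (cong (j₀ ℕ.+_) (ℕP.*-comm c p-1))) ⟩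
        x ^ (j₀ ℕ.+ p-1 ℕ.* c) - x ^ j₀         ≡⟨ cong (_- x ^ j₀) (^-homo-* x j₀ (p-1 ℕ.* c)) ⟩
        x ^ j₀ * x ^ (p-1 ℕ.* c) - x ^ j₀       ≡⟨ solve 2 (λ a b → a :* b :- a := a :* (b :- con 1ℚ)) refl (x ^ j₀) (x ^ (p-1 ℕ.* c)) ⟩
        x ^ j₀ * (x ^ (p-1 ℕ.* c) - 1ℚ)         ∎
    recombine : ∑[ k < p ] (ι k ^ j - ι k ^ j₀) + powerSum j₀ ≡ powerSum j
    recombine = trans (cong (_+ powerSum j₀) (∑-sub (λ k → ι k ^ j) (λ k → ι k ^ j₀) p))
                      (solve 2 (λ a b → a :- b :+ b := a) refl (powerSum j) (powerSum j₀))

  -- Harmonic sums over the units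

  unitInvPow : ℕ → ℕ → ℚ
  unitInvPow s k with Coprime.coprime? k p
  ... | yes _ = invPow k s
  ... | no _  = 0ℚ

  H : ℕ → ℕ → ℚ
  H s N = ∑[ k < N ] unitInvPow s k

  unitInvPow-coprime : ∀ s {k} → Coprime k p → unitInvPow s k ≡ invPow k s
  unitInvPow-coprime s {k} k⊥p with Coprime.coprime? k p
  ... | yes _    = refl
  ... | no  k⊥̸p = ⊥-elim (k⊥̸p k⊥p)

  unitInvPow-¬coprime : ∀ s {k} → ¬ Coprime k p → unitInvPow s k ≡ 0ℚ
  unitInvPow-¬coprime s {k} k⊥̸p with Coprime.coprime? k p
  ... | yes k⊥p = ⊥-elim (k⊥̸p k⊥p)
  ... | no  _   = refl

  unitInvPow-unit : ∀ s {k} → p ∤ k → unitInvPow s k ≡ invPow k s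
  unitInvPow-unit s p∤k = unitInvPow-coprime s (p∤⇒coprime p∤k)

  unitInvPow-nonunit : ∀ s {k} → p ∣ k → unitInvPow s k ≡ 0ℚ
  unitInvPow-nonunit s p∣k = unitInvPow-¬coprime s (λ k⊥p → coprime⇒p∤ k⊥p p∣k)

  integral-unitInvPow : ∀ s k → Integral (unitInvPow s k)
  integral-unitInvPow s zero    = subst Integral (sym (unitInvPow-nonunit s (p ℕD.∣0))) (integral-ι 0)
  integral-unitInvPow s (suc j) with p ℕD.∣? suc j
  ... | yes p∣k = subst Integral (sym (unitInvPow-nonunit s p∣k)) (integral-ι 0)
  ... | no  p∤k = subst Integral (sym (unitInvPow-unit s p∤k)) (integral-invPow j s p∤k)

  coprimeHarmonicSum≡H : ∀ N s → coprimeHarmonicSum p N s ≡ H s N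
  coprimeHarmonicSum≡H zero    s = refl
  coprimeHarmonicSum≡H (suc N) s = begin
    coprimeHarmonicSum p (suc N) s                    ≡⟨ foldr-filter (λ k → Coprime.coprime? k p) (λ k → invPow k s) (unitInvPow s)
                                                           (unitInvPow-coprime s) (unitInvPow-¬coprime s) (map suc (applyUpTo (λ i → i) N)) ⟩
    foldr (λ k acc → unitInvPow s k + acc) 0ℚ (map suc (applyUpTo (λ i → i) N))
                                                      ≡⟨ foldr-map-suc-applyUpTo (unitInvPow s) (λ i → i) N ⟩
    ∑[ i < N ] unitInvPow s (suc i)                   ≡⟨ sym (ℚP.+-identityˡ _) ⟩
    0ℚ + ∑[ i < N ] unitInvPow s (suc i)              ≡⟨ cong (_+ ∑[ i < N ] unitInvPow s (suc i)) (sym (unitInvPow-nonunit s (p ℕD.∣0))) ⟩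
    unitInvPow s 0 + ∑[ i < N ] unitInvPow s (suc i)  ≡⟨ sym (∑-shift (unitInvPow s) N) ⟩
    H s (suc N)                                       ∎

  1≤ᵥH-p : ∀ e → p-1 ∤ e → 1 ≤ᵥ H e p
  1≤ᵥH-p e p-1∤e = subst (1 ≤ᵥ_) recombine
    (≤ᵥ-+ (≤ᵥ-∑ (λ k → unitInvPow e k - ι k ^ j) p difference-val) (powerSum-nonmultiple j p-1∤j))
    where
    p-2 = p-1 ℕ.∸ 1
    suc[p-2]≡p-1 : suc p-2 ≡ p-1
    suc[p-2]≡p-1 = ℕP.m+[n∸m]≡n (ℕP.m<n⇒0<n∸m 1<p)
    -- k⁻ᵉ ≡ k^((p-2)e) for units k, by Fermat
    j = p-2 ℕ.* e
    p-1∣j+e : p-1 ∣ j ℕ.+ e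
    p-1∣j+e = subst (p-1 ∣_) (ℕP.+-comm e j) (subst (λ n → p-1 ∣ n ℕ.* e) (sym suc[p-2]≡p-1) (ℕD.m∣m*n e))
    p-1∤j : p-1 ∤ j
    p-1∤j p-1∣j = p-1∤e (ℕD.∣m+n∣m⇒∣n p-1∣j+e p-1∣j)
    j≢0 : j ≢ 0
    j≢0 j≡0 = p-1∤j (subst (p-1 ∣_) (sym j≡0) (p-1 ℕD.∣0))
    difference-val : ∀ k → k < p → 1 ≤ᵥ unitInvPow e k - ι k ^ j
    difference-val zero    _   = subst (1 ≤ᵥ_)
      (sym (trans (cong₂ _-_ (unitInvPow-nonunit e (p ℕD.∣0)) (0^n≡0 j j≢0)) (ℚP.+-inverseʳ 0ℚ))) (≤ᵥ-0 1)
    difference-val (suc k) k<p = subst (1 ≤ᵥ_) (sym factor)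
      (≤ᵥ-*ˡ (integral-neg (integral-invPow k e p∤k)) (fermat-unit-^ k p∤k e))
      where
      p∤k = p∤-small (s≤s z≤n) k<p
      x = ι (suc k)
      a = invPow (suc k) e
      factor : unitInvPow e (suc k) - x ^ j ≡ - a * (x ^ (p-1 ℕ.* e) - 1ℚ)
      factor = sym (begin
        - a * (x ^ (p-1 ℕ.* e) - 1ℚ)    ≡⟨ cong (λ n → - a * (x ^ (n ℕ.* e) - 1ℚ)) (sym suc[p-2]≡p-1) ⟩
        - a * (x ^ (e ℕ.+ j) - 1ℚ)      ≡⟨ cong (λ z → - a * (z - 1ℚ)) (^-homo-* x e j) ⟩
        - a * (x ^ e * x ^ j - 1ℚ)      ≡⟨ solve 3 (λ a X y → (:- a) :* (X :* y :- con 1ℚ) := a :- (a :* X) :* y) refl a (x ^ e) (x ^ j) ⟩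
        a - (a * x ^ e) * x ^ j         ≡⟨ cong (λ z → a - z * x ^ j) (invPow-inverse k e) ⟩
        a - 1ℚ * x ^ j                  ≡⟨ cong (λ z → a - z) (ℚP.*-identityˡ (x ^ j)) ⟩
        a - x ^ j                       ≡⟨ cong (_- x ^ j) (sym (unitInvPow-unit e p∤k)) ⟩
        unitInvPow e (suc k) - x ^ j    ∎)
    recombine : ∑[ k < p ] (unitInvPow e k - ι k ^ j) + powerSum j ≡ H e p
    recombine = trans (cong (_+ powerSum j) (∑-sub (unitInvPow e) (λ k → ι k ^ j) p))
                      (solve 2 (λ a b → a :- b :+ b := a) refl (H e p) (powerSum j))

  unitInvPow-shift : ∀ {a t} e r → p ℕ.^ suc a ∣ t →
    suc a ℕ.+ suc a ≤ᵥ unitInvPow e (t ℕ.+ r) - (unitInvPow e r - ι t * (ι e * unitInvPow (suc e) r))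
  unitInvPow-shift {a} {t} e r pᵃ⁺¹∣t = term r
    where
    p∣t : p ∣ t
    p∣t = p^[1+a]∣⇒p∣ a pᵃ⁺¹∣t
    nonunit : ∀ {r} → p ∣ r → suc a ℕ.+ suc a ≤ᵥ unitInvPow e (t ℕ.+ r) - (unitInvPow e r - ι t * (ι e * unitInvPow (suc e) r))
    nonunit {r} p∣r = subst (suc a ℕ.+ suc a ≤ᵥ_) (sym (begin
      unitInvPow e (t ℕ.+ r) - (unitInvPow e r - ι t * (ι e * unitInvPow (suc e) r))
                                                  ≡⟨ cong₂ (λ x y → x - (y - ι t * (ι e * unitInvPow (suc e) r)))
                                                       (unitInvPow-nonunit e (ℕD.∣m∣n⇒∣m+n p∣t p∣r)) (unitInvPow-nonunit e p∣r) ⟩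
      0ℚ - (0ℚ - ι t * (ι e * unitInvPow (suc e) r))  ≡⟨ cong (λ z → 0ℚ - (0ℚ - ι t * (ι e * z))) (unitInvPow-nonunit (suc e) p∣r) ⟩
      0ℚ - (0ℚ - ι t * (ι e * 0ℚ))                ≡⟨ solve 2 (λ t e → con 0ℚ :- (con 0ℚ :- t :* (e :* con 0ℚ)) := con 0ℚ) refl (ι t) (ι e) ⟩
      0ℚ                                          ∎)) (≤ᵥ-0 _)
    term : ∀ r → suc a ℕ.+ suc a ≤ᵥ unitInvPow e (t ℕ.+ r) - (unitInvPow e r - ι t * (ι e * unitInvPow (suc e) r))
    term zero = nonunit (p ℕD.∣0)
    term (suc j) with p ℕD.∣? suc j
    ... | yes p∣k = nonunit p∣k
    ... | no  p∤k = subst (suc a ℕ.+ suc a ≤ᵥ_) (sym term≡expansion)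
      (reciprocal-power-expansion (integral-invPow j 1 p∤k) (integral-invPow k′ 1 p∤k′) (invPow-inverse₁ j) (invPow-inverse₁ k′)
        (subst (suc a ≤ᵥ_) (sym v-u≡t) (≤ᵥ-ι pᵃ⁺¹∣t)) e)
      where
      k′ = t ℕ.+ j
      p∤k′ : p ∤ suc k′
      p∤k′ p∣k′ = p∤k (ℕD.∣m+n∣m⇒∣n (subst (p ∣_) (sym (ℕP.+-suc t j)) p∣k′) p∣t)
      X = invPow (suc j) 1
      Y = invPow (suc k′) 1
      u = ι (suc j)
      v = ι (suc k′)
      v-u≡t : v - u ≡ ι t
      v-u≡t = begin
        ι (suc k′) - u      ≡⟨ cong (λ z → ι z - u) (sym (ℕP.+-suc t j)) ⟩
        ι (t ℕ.+ suc j) - u ≡⟨ cong (_- u) (ι-+ t (suc j)) ⟩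
        ι t + u - u         ≡⟨ solve 2 (λ t u → t :+ u :- u := t) refl (ι t) u ⟩
        ι t                 ∎
      term≡expansion : unitInvPow e (t ℕ.+ suc j) - (unitInvPow e (suc j) - ι t * (ι e * unitInvPow (suc e) (suc j)))
                     ≡ Y ^ e - X ^ e + ι e * (v - u) * X ^ suc e
      term≡expansion = begin
        unitInvPow e (t ℕ.+ suc j) - (unitInvPow e (suc j) - ι t * (ι e * unitInvPow (suc e) (suc j)))
          ≡⟨ cong₂ (λ y x′ → y - (unitInvPow e (suc j) - ι t * (ι e * x′)))
               (trans (cong (unitInvPow e) (ℕP.+-suc t j)) (unitInvPow-unit e p∤k′))
               (unitInvPow-unit (suc e) p∤k) ⟩
        invPow (suc k′) e - (unitInvPow e (suc j) - ι t * (ι e * invPow (suc j) (suc e)))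
          ≡⟨ cong (λ x → invPow (suc k′) e - (x - ι t * (ι e * invPow (suc j) (suc e)))) (unitInvPow-unit e p∤k) ⟩
        invPow (suc k′) e - (invPow (suc j) e - ι t * (ι e * invPow (suc j) (suc e)))
          ≡⟨ cong₂ (λ y x → y - x) (invPow-^ k′ e) (cong₂ (λ x x′ → x - ι t * (ι e * x′)) (invPow-^ j e) (invPow-^ j (suc e))) ⟩
        Y ^ e - (X ^ e - ι t * (ι e * X ^ suc e))
          ≡⟨ solve 5 (λ y x t E x′ → y :- (x :- t :* (E :* x′)) := y :- x :+ E :* t :* x′) refl (Y ^ e) (X ^ e) (ι t) (ι e) (X ^ suc e) ⟩
        Y ^ e - X ^ e + ι e * ι t * X ^ suc e
          ≡⟨ cong (λ z → Y ^ e - X ^ e + ι e * z * X ^ suc e) (sym v-u≡t) ⟩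
        Y ^ e - X ^ e + ι e * (v - u) * X ^ suc e ∎

  H-shift : ∀ {a t} e n → p ℕ.^ suc a ∣ t →
    suc a ℕ.+ suc a ≤ᵥ ∑[ r < n ] unitInvPow e (t ℕ.+ r) - (H e n - ι t * (ι e * H (suc e) n))
  H-shift {a} {t} e n pᵃ⁺¹∣t =
    subst (suc a ℕ.+ suc a ≤ᵥ_) regroup (≤ᵥ-∑ _ n (λ r _ → unitInvPow-shift e r pᵃ⁺¹∣t))
    where
    shifted = ∑[ r < n ] unitInvPow e (t ℕ.+ r)
    regroup : ∑[ r < n ] (unitInvPow e (t ℕ.+ r) - (unitInvPow e r - ι t * (ι e * unitInvPow (suc e) r)))
            ≡ shifted - (H e n - ι t * (ι e * H (suc e) n))
    regroup = begin
      ∑[ r < n ] (unitInvPow e (t ℕ.+ r) - (unitInvPow e r - ι t * (ι e * unitInvPow (suc e) r)))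
                                                                                    ≡⟨ ∑-sub _ _ n ⟩
      shifted - ∑[ r < n ] (unitInvPow e r - ι t * (ι e * unitInvPow (suc e) r))  ≡⟨ cong (λ z → shifted - z) (∑-sub _ _ n) ⟩
      shifted - (H e n - ∑[ r < n ] (ι t * (ι e * unitInvPow (suc e) r)))         ≡⟨ cong (λ z → shifted - (H e n - z)) (∑-*ˡ (ι t) _ n) ⟩
      shifted - (H e n - ι t * (∑[ r < n ] (ι e * unitInvPow (suc e) r)))         ≡⟨ cong (λ z → shifted - (H e n - ι t * z)) (∑-*ˡ (ι e) _ n) ⟩
      shifted - (H e n - ι t * (ι e * H (suc e) n))                               ∎

  H-blocks : ∀ a e m → let M = p ℕ.^ suc a in
    suc a ℕ.+ suc a ≤ᵥ H e (m ℕ.* M) - (ι m * H e M - ∑ m ι * (ι M * (ι e * H (suc e) M)))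
  H-blocks a e m = subst (suc a ℕ.+ suc a ≤ᵥ_) regroup
    (≤ᵥ-∑ _ m (λ i _ → H-shift {t = i ℕ.* M} e M (ℕD.n∣m*n i)))
    where
    M = p ℕ.^ suc a
    K = ι e * H (suc e) M
    block : ℕ → ℚ
    block i = ∑[ r < M ] unitInvPow e (i ℕ.* M ℕ.+ r)
    shift-sum : ∑[ i < m ] (ι (i ℕ.* M) * K) ≡ ∑ m ι * (ι M * K)
    shift-sum = begin
      ∑[ i < m ] (ι (i ℕ.* M) * K)  ≡⟨ ∑-cong m (λ i _ → trans (cong (_* K) (ι-* i M)) (ℚP.*-assoc (ι i) (ι M) K)) ⟩
      ∑[ i < m ] (ι i * (ι M * K))  ≡⟨ ∑-*ʳ ι (ι M * K) m ⟩
      ∑ m ι * (ι M * K)             ∎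
    regroup : ∑[ i < m ] (block i - (H e M - ι (i ℕ.* M) * K)) ≡ H e (m ℕ.* M) - (ι m * H e M - ∑ m ι * (ι M * K))
    regroup = begin
      ∑[ i < m ] (block i - (H e M - ι (i ℕ.* M) * K))                        ≡⟨ ∑-sub block _ m ⟩
      ∑ m block - ∑[ i < m ] (H e M - ι (i ℕ.* M) * K)                        ≡⟨ cong₂ _-_ (sym (∑-blocks (unitInvPow e) M m)) (∑-sub _ _ m) ⟩
      H e (m ℕ.* M) - (∑[ _ < m ] H e M - ∑[ i < m ] (ι (i ℕ.* M) * K))       ≡⟨ cong₂ (λ x y → H e (m ℕ.* M) - (x - y)) (∑-const (H e M) m) shift-sum ⟩
      H e (m ℕ.* M) - (ι m * H e M - ∑ m ι * (ι M * K))                       ∎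

  H-multiple : ∀ {r} a e m → let M = p ℕ.^ suc a in
    r ≤ suc a ℕ.+ suc a → r ≤ᵥ ι m * H e M → r ≤ᵥ ∑ m ι * ι M → r ≤ᵥ H e (m ℕ.* M)
  H-multiple {r} a e m r≤2a+2 mH-val ∑M-val = subst (r ≤ᵥ_) (solve 2 (λ h R → h :- R :+ R := h) refl (H e (m ℕ.* M)) R)
    (≤ᵥ-+ (≤ᵥ-weaken r≤2a+2 (H-blocks a e m))
          (≤ᵥ-sub mH-val (subst (r ≤ᵥ_) (ℚP.*-assoc (∑ m ι) (ι M) K) (≤ᵥ-*ʳ K-int ∑M-val))))
    where
    M = p ℕ.^ suc a
    K = ι e * H (suc e) M
    K-int : Integral K
    K-int = integral-* (integral-ι e) (integral-∑ (unitInvPow (suc e)) M (integral-unitInvPow (suc e)))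
    R = ι m * H e M - ∑ m ι * (ι M * K)

  unitInvPow-reflect : ∀ {a N s k} → 2 ∤ s → p ℕ.^ suc a ∣ N → k < N →
    suc a ℕ.+ suc a ≤ᵥ unitInvPow s k + unitInvPow s (N ℕ.∸ k) + ι s * ι N * unitInvPow (suc s) k
  unitInvPow-reflect {a} {N} {s} {k} 2∤s pᵃ⁺¹∣N k<N = term k k<N
    where
    p∣N : p ∣ N
    p∣N = p^[1+a]∣⇒p∣ a pᵃ⁺¹∣N
    nonunit : ∀ {k} → k < N → p ∣ k →
      suc a ℕ.+ suc a ≤ᵥ unitInvPow s k + unitInvPow s (N ℕ.∸ k) + ι s * ι N * unitInvPow (suc s) k
    nonunit {k} k<N p∣k = subst (suc a ℕ.+ suc a ≤ᵥ_) (sym (begin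
      unitInvPow s k + unitInvPow s (N ℕ.∸ k) + ι s * ι N * unitInvPow (suc s) k
                                                ≡⟨ cong₂ (λ x y → x + y + ι s * ι N * unitInvPow (suc s) k)
                                                     (unitInvPow-nonunit s p∣k) (unitInvPow-nonunit s p∣N∸k) ⟩
      0ℚ + 0ℚ + ι s * ι N * unitInvPow (suc s) k ≡⟨ cong (λ z → 0ℚ + 0ℚ + ι s * ι N * z) (unitInvPow-nonunit (suc s) p∣k) ⟩
      0ℚ + 0ℚ + ι s * ι N * 0ℚ                  ≡⟨ solve 2 (λ S n → con 0ℚ :+ con 0ℚ :+ S :* n :* con 0ℚ := con 0ℚ) refl (ι s) (ι N) ⟩
      0ℚ                                        ∎)) (≤ᵥ-0 _)
      where
      p∣N∸k : p ∣ N ℕ.∸ k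
      p∣N∸k = ℕD.∣m+n∣m⇒∣n (subst (p ∣_) (sym (ℕP.m+[n∸m]≡n (ℕP.<⇒≤ k<N))) p∣N) p∣k
    term : ∀ k → k < N →
      suc a ℕ.+ suc a ≤ᵥ unitInvPow s k + unitInvPow s (N ℕ.∸ k) + ι s * ι N * unitInvPow (suc s) k
    term zero    0<N = nonunit 0<N (p ℕD.∣0)
    term (suc j) k<N with p ℕD.∣? suc j
    ... | yes p∣k = nonunit k<N p∣k
    ... | no  p∤k = subst (suc a ℕ.+ suc a ≤ᵥ_) (sym term≡expansion)
      (reciprocal-power-expansion (integral-neg (integral-invPow j 1 p∤k)) (integral-invPow j′ 1 p∤k′) Xu≡1 (invPow-inverse₁ j′)
        (subst (suc a ≤ᵥ_) (sym v-u≡N) (≤ᵥ-ι pᵃ⁺¹∣N)) s)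
      where
      j′ = N ℕ.∸ suc (suc j)
      N∸k≡1+j′ : N ℕ.∸ suc j ≡ suc j′
      N∸k≡1+j′ = ℕP.+-∸-assoc 1 k<N
      p∤k′ : p ∤ suc j′
      p∤k′ p∣k′ = p∤k (ℕD.∣m+n∣m⇒∣n (subst (p ∣_) (sym (ℕP.m∸n+n≡m (ℕP.<⇒≤ k<N))) p∣N)
                                     (subst (p ∣_) (sym N∸k≡1+j′) p∣k′))
      -- (N − k)⁻¹ is expanded around (−k)⁻¹; since s is odd, (−k)⁻ˢ = −k⁻ˢ.
      A = invPow (suc j) 1
      X = - A
      Y = invPow (suc j′) 1
      u = - ι (suc j)
      v = ι (suc j′)
      Xu≡1 : X * u ≡ 1ℚ
      Xu≡1 = trans (solve 2 (λ a k → (:- a) :* (:- k) := a :* k) refl A (ι (suc j))) (invPow-inverse₁ j)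
      v-u≡N : v - u ≡ ι N
      v-u≡N = begin
        v - u                                 ≡⟨ solve 2 (λ v k → v :- (:- k) := v :+ k) refl v (ι (suc j)) ⟩
        ι (suc j′) + ι (suc j)                ≡⟨ cong (λ z → ι z + ι (suc j)) (sym N∸k≡1+j′) ⟩
        ι (N ℕ.∸ suc j) + ι (suc j)           ≡⟨ sym (ι-+ (N ℕ.∸ suc j) (suc j)) ⟩
        ι (N ℕ.∸ suc j ℕ.+ suc j)             ≡⟨ cong ι (ℕP.m∸n+n≡m (ℕP.<⇒≤ k<N)) ⟩
        ι N                                   ∎
      term≡expansion : unitInvPow s (suc j) + unitInvPow s (N ℕ.∸ suc j) + ι s * ι N * unitInvPow (suc s) (suc j)
                     ≡ Y ^ s - X ^ s + ι s * (v - u) * X ^ suc s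
      term≡expansion = begin
        unitInvPow s (suc j) + unitInvPow s (N ℕ.∸ suc j) + ι s * ι N * unitInvPow (suc s) (suc j)
          ≡⟨ cong₂ (λ x y → x + y + ι s * ι N * unitInvPow (suc s) (suc j))
               (trans (unitInvPow-unit s p∤k) (invPow-^ j s))
               (trans (cong (unitInvPow s) N∸k≡1+j′) (trans (unitInvPow-unit s p∤k′) (invPow-^ j′ s))) ⟩
        A ^ s + Y ^ s + ι s * ι N * unitInvPow (suc s) (suc j)
          ≡⟨ cong (λ z → A ^ s + Y ^ s + ι s * ι N * z) (trans (unitInvPow-unit (suc s) p∤k) (invPow-^ j (suc s))) ⟩
        A ^ s + Y ^ s + ι s * ι N * (A * A ^ s)
          ≡⟨ solve 5 (λ a b y S n → b :+ y :+ S :* n :* (a :* b) := y :- (:- b) :+ S :* n :* ((:- a) :* (:- b))) refl A (A ^ s) (Y ^ s) (ι s) (ι N) ⟩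
        Y ^ s - (- (A ^ s)) + ι s * ι N * (X * (- (A ^ s)))
          ≡⟨ cong (λ z → Y ^ s - z + ι s * ι N * (X * z)) (sym (-‿^-odd A s 2∤s)) ⟩
        Y ^ s - X ^ s + ι s * ι N * X ^ suc s
          ≡⟨ cong (λ z → Y ^ s - X ^ s + ι s * z * X ^ suc s) (sym v-u≡N) ⟩
        Y ^ s - X ^ s + ι s * (v - u) * X ^ suc s ∎

  H-reflection : ∀ {a N s} → 2 ∤ s → p ℕ.^ suc a ∣ N →
    suc a ℕ.+ suc a ≤ᵥ ι 2 * H s N + ι s * ι N * H (suc s) N
  H-reflection {a} {N} {s} 2∤s pᵃ⁺¹∣N =
    subst (suc a ℕ.+ suc a ≤ᵥ_) (sym regroup) (≤ᵥ-∑ _ N (λ k → unitInvPow-reflect 2∤s pᵃ⁺¹∣N))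
    where
    regroup : ι 2 * H s N + ι s * ι N * H (suc s) N
            ≡ ∑[ k < N ] (unitInvPow s k + unitInvPow s (N ℕ.∸ k) + ι s * ι N * unitInvPow (suc s) k)
    regroup = begin
      ι 2 * H s N + ι s * ι N * H (suc s) N
        ≡⟨ cong (_+ ι s * ι N * H (suc s) N) (solve 1 (λ h → (con 1ℚ :+ (con 1ℚ :+ con 0ℚ)) :* h := h :+ h) refl (H s N)) ⟩
      H s N + H s N + ι s * ι N * H (suc s) N
        ≡⟨ cong₂ (λ x y → H s N + x + y)
             (∑-reflect (unitInvPow s) N (trans (unitInvPow-nonunit s (p ℕD.∣0)) (sym (unitInvPow-nonunit s p∣N))))
             (sym (∑-*ˡ (ι s * ι N) (unitInvPow (suc s)) N)) ⟩
      H s N + ∑[ k < N ] unitInvPow s (N ℕ.∸ k) + ∑[ k < N ] (ι s * ι N * unitInvPow (suc s) k)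
        ≡⟨ cong (_+ ∑[ k < N ] (ι s * ι N * unitInvPow (suc s) k)) (sym (∑-+ (unitInvPow s) _ N)) ⟩
      ∑[ k < N ] (unitInvPow s k + unitInvPow s (N ℕ.∸ k)) + ∑[ k < N ] (ι s * ι N * unitInvPow (suc s) k)
        ≡⟨ sym (∑-+ _ _ N) ⟩
      ∑[ k < N ] (unitInvPow s k + unitInvPow s (N ℕ.∸ k) + ι s * ι N * unitInvPow (suc s) k) ∎
      where
      p∣N : p ∣ N
      p∣N = p^[1+a]∣⇒p∣ a pᵃ⁺¹∣N

  module Odd (p-odd : 2 ∤ p) where

    p∤2 : p ∤ 2
    p∤2 p∣2 with prime⇒irreducible prime[2] p∣2
    ... | inj₁ p≡1 = ℕP.<-irrefl (sym p≡1) 1<p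
    ... | inj₂ refl = p-odd ℕD.∣-refl

    ∑ι-p : 1 ≤ᵥ ∑ p ι
    ∑ι-p = ≤ᵥ-cancel-unit 1 p∤2 (subst (1 ≤ᵥ_) (sym gauss) (≤ᵥ-*ʳ (integral-ι p-1) (1≤ᵥι ℕD.∣-refl)))
      where
      gauss : ι 2 * ∑ p ι ≡ ι p * ι p-1
      gauss = subst (λ n → ι 2 * ∑ n ι ≡ ι n * ι p-1) suc[p-1]≡p (2*∑ι p-1)

    a+d≤1+a : ∀ {a d} → d ≤ 1 → a ℕ.+ d ≤ suc a
    a+d≤1+a {a} d≤1 = ℕP.≤-trans (ℕP.+-monoʳ-≤ a d≤1) (ℕP.≤-reflexive (ℕP.+-comm a 1))

    l+d≤ᵥH-p^ : ∀ e d → d ≤ 1 → d ≤ᵥ H e p → ∀ a → a ℕ.+ d ≤ᵥ H e (p ℕ.^ suc a)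
    l+d≤ᵥH-p^ e d d≤1 base zero    = subst (λ n → d ≤ᵥ H e n) (sym (ℕP.*-identityʳ p)) base
    l+d≤ᵥH-p^ e d d≤1 base (suc a) = H-multiple a e p
      (ℕP.+-monoʳ-≤ (suc a) (ℕP.≤-trans d≤1 (s≤s z≤n)))
      (≤ᵥ-* (1≤ᵥι ℕD.∣-refl) (l+d≤ᵥH-p^ e d d≤1 base a))
      (≤ᵥ-weaken (s≤s (a+d≤1+a d≤1)) (≤ᵥ-* ∑ι-p (≤ᵥ-ι ℕD.∣-refl)))

    l+d≤ᵥH : ∀ e d → d ≤ 1 → d ≤ᵥ H e p → ∀ l m → l ℕ.+ d ≤ᵥ H e (m ℕ.* p ℕ.^ suc l)
    l+d≤ᵥH e d d≤1 base l m = H-multiple l e m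
      (ℕP.≤-trans (a+d≤1+a d≤1) (ℕP.m≤m+n (suc l) (suc l)))
      (≤ᵥ-*ˡ (integral-ι m) (l+d≤ᵥH-p^ e d d≤1 base l))
      (≤ᵥ-*ˡ (integral-∑ ι m integral-ι) (≤ᵥ-weaken (a+d≤1+a d≤1) (≤ᵥ-ι ℕD.∣-refl)))

    l≤ᵥH : ∀ e l m → l ≤ᵥ H e (m ℕ.* p ℕ.^ suc l)
    l≤ᵥH e l m = subst (_≤ᵥ H e (m ℕ.* p ℕ.^ suc l)) (ℕP.+-identityʳ l)
      (l+d≤ᵥH e 0 z≤n (integral⇒0≤ᵥ (integral-∑ _ p (integral-unitInvPow e))) l m)

    1+l≤ᵥH : ∀ e → p-1 ∤ e → ∀ l m → suc l ≤ᵥ H e (m ℕ.* p ℕ.^ suc l)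
    1+l≤ᵥH e p-1∤e l m = subst (_≤ᵥ H e (m ℕ.* p ℕ.^ suc l)) (ℕP.+-comm l 1) (l+d≤ᵥH e 1 ℕP.≤-refl (1≤ᵥH-p e p-1∤e) l m)

    H-odd : ∀ {r a N s} → 2 ∤ s → p ℕ.^ suc a ∣ N → r ≤ suc a ℕ.+ suc a →
      r ≤ᵥ ι s * ι N * H (suc s) N → r ≤ᵥ H s N
    H-odd {r} {a} {N} {s} 2∤s pᵃ⁺¹∣N r≤2a+2 tail-val = ≤ᵥ-cancel-unit 1 p∤2 (subst (r ≤ᵥ_)
      (solve 2 (λ h t → h :+ t :- t := h) refl (ι 2 * H s N) (ι s * ι N * H (suc s) N))
      (≤ᵥ-sub (≤ᵥ-weaken r≤2a+2 (H-reflection 2∤s pᵃ⁺¹∣N)) tail-val))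

lemma2p1 : (p l m s : ℕ) → Prime p → 2 ∤ p → 1 ≤ l → 1 ≤ m → 1 ≤ s →
    ((2 ∤ s → (p ℕ.∸ 1) ∣ (s ℕ.+ 1) → p ∤ s →
        ≡0modPow p (2 ℕ.* l ℕ.∸ 1) (coprimeHarmonicSum p (m ℕ.* p ℕ.^ l) s))
    × (2 ∤ s → ((p ℕ.∸ 1) ∤ (s ℕ.+ 1) ⊎ p ∣ s) →
        ≡0modPow p (2 ℕ.* l) (coprimeHarmonicSum p (m ℕ.* p ℕ.^ l) s))
    × (2 ∣ s → (p ℕ.∸ 1) ∣ s →
        ≡0modPow p (l ℕ.∸ 1) (coprimeHarmonicSum p (m ℕ.* p ℕ.^ l) s))
    × (2 ∣ s → (p ℕ.∸ 1) ∤ s →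
        ≡0modPow p l (coprimeHarmonicSum p (m ℕ.* p ℕ.^ l) s)))
lemma2p1 p (suc l) m s p-prime p-odd _ _ _ =
    (λ 2∤s _ _ → conclude (subst (_≤ᵥ H s N) 1+l+l≡2[1+l]∸1
       (H-odd 2∤s pˡ⁺¹∣N (ℕP.+-monoʳ-≤ (suc l) (ℕP.n≤1+n l)) (≤ᵥ-* sN-val (l≤ᵥH (suc s) l m)))))
  , (λ { 2∤s (inj₁ p-1∤s+1) → conclude (subst (_≤ᵥ H s N) 1+l+1+l≡2[1+l] (H-odd 2∤s pˡ⁺¹∣N ℕP.≤-refl
             (≤ᵥ-* sN-val (1+l≤ᵥH (suc s) (subst (p-1 ∤_) (ℕP.+-comm s 1) p-1∤s+1) l m))))
       ; 2∤s (inj₂ p∣s)      → conclude (subst (_≤ᵥ H s N) 1+l+1+l≡2[1+l] (H-odd 2∤s pˡ⁺¹∣N ℕP.≤-refl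
             (subst (_≤ᵥ ι s * ι N * H (suc s) N) (cong suc (sym (ℕP.+-suc l l)))
               (≤ᵥ-* (≤ᵥ-* (1≤ᵥι p∣s) (≤ᵥ-ι pˡ⁺¹∣N)) (l≤ᵥH (suc s) l m))))) })
  , (λ _ _ → conclude (l≤ᵥH s l m))
  , (λ _ p-1∤s → conclude (1+l≤ᵥH s p-1∤s l m))
  where
  open Valuation p-prime
  open Odd p-odd
  N = m ℕ.* p ℕ.^ suc l
  pˡ⁺¹∣N : p ℕ.^ suc l ∣ N
  pˡ⁺¹∣N = ℕD.n∣m*n m
  sN-val : suc l ≤ᵥ ι s * ι N
  sN-val = ≤ᵥ-*ˡ (integral-ι s) (≤ᵥ-ι pˡ⁺¹∣N)
  conclude : ∀ {r} → r ≤ᵥ H s N → ≡0modPow p r (coprimeHarmonicSum p N s)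
  conclude {r} val = subst (≡0modPow p r) (sym (coprimeHarmonicSum≡H N s)) (≤ᵥ⇒≡0modPow val)
  1+l+l≡2[1+l]∸1 : suc l ℕ.+ l ≡ 2 ℕ.* suc l ℕ.∸ 1
  1+l+l≡2[1+l]∸1 = trans (sym (ℕP.+-suc l l)) (cong (λ z → l ℕ.+ suc z) (sym (ℕP.+-identityʳ l)))
  1+l+1+l≡2[1+l] : suc l ℕ.+ suc l ≡ 2 ℕ.* suc l
  1+l+1+l≡2[1+l] = cong (suc l ℕ.+_) (sym (ℕP.+-identityʳ (suc l)))
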